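{- Let $n\ge1$, let $0\le i,j\le\lfloor\frac{n+1}{2}\rfloor$, and let $k,\ell$ be positive integers such that $X=A_n\,k(n+1)\left[i\,\tfrac{1}{n+1}\right]$ and $Y=A_n\,\ell(n+1)\left[j\,\tfrac{1}{n+1}\right]$ are integral lattices. Suppose that both $X$ and $Y$ have $A_n$ as their root sublattice (the sublattice generated by all vectors $x$ with $Q(x)\le 2$). Then $X$ is represented by $Y$ if and only if there exists a positive integer $t$ such that $jt\equiv\pm i\pmod{n+1}$ and $k=\ell t^2$.
   Context: Lattices are finitely generated $\mathbb{Z}$-modules on positive definite quadratic spaces over $\mathbb{Q}$ with quadratic map $Q$ and bilinear form $B$; integral means $B(L,L)\subseteq\mathbb{Z}$. $M$ is represented by $L$ if there is a linear map $\sigma:M\to L$ with $Q(\sigma(x))=Q(x)$. $A_n=\{(a_0,\dots,a_n)\in\mathbb{Z}^{n+1}:\sum a_i=0\}$ with the dot product; its glue vectors are, for $0\le i\le n$ and $j'=n+1-i$, $\lbrack i\rbrack=(\frac{i}{n+1},\dots,\frac{i}{n+1},\frac{ -j'}{n+1},\dots,\frac{ -j'}{n+1})$ with $j'$ entries $\frac{i}{n+1}$ and $i$ entries $\frac{ -j'}{n+1}$. The notation $A_n\,c\left[i\,\frac{1}{n+1}\right]$ denotes $(A_n\perp\mathbb{Z}z)+\mathbb{Z}\left(\lbrack i\rbrack+\frac{z}{n+1}\right)$ with $z$ orthogonal to $A_n$ and $Q(z)=c$. -}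

module Defs where

open import Data.Nat as ℕ using (ℕ; zero; suc; _∸_; _<ᵇ_)
open import Data.Integer as ℤ using (ℤ; +_)
open import Data.Rational as ℚ using (ℚ; 0ℚ; _/_)
open import Data.Fin using (Fin; toℕ)
import Data.Fin as Fin
open import Data.Bool using (if_then_else_)
open import Data.Product using (Σ; _×_; ∃)
open import Relation.Binary.PropositionalEquality using (_≡_)

sumℚ : ∀ {m} → (Fin m → ℚ) → ℚ
sumℚ {zero}  f = 0ℚ
sumℚ {suc m} f = f Fin.zero ℚ.+ sumℚ (λ r → f (Fin.suc r))

sumℤ : ∀ {m} → (Fin m → ℤ) → ℤ
sumℤ {zero}  f = + 0
sumℤ {suc m} f = f Fin.zero ℤ.+ sumℤ (λ r → f (Fin.suc r))

ι : ℤ → ℚ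
ι a = a / 1

-- Ambient space of A_n ⊥ ℚz : a vector of ℚ^{n+1} (the A_n part,
-- coordinates 0..n) together with the coefficient of z.
V : ℕ → Set
V n = (Fin (suc n) → ℚ) × ℚ

open Data.Product using (_,_; proj₁; proj₂) public

_+V_ : ∀ {n} → V n → V n → V n
(u , s) +V (v , t) = (λ r → u r ℚ.+ v r) , (s ℚ.+ t)

_≈V_ : ∀ {n} → V n → V n → Set
(u , s) ≈V (v , t) = (∀ r → u r ≡ v r) × (s ≡ t)

-- Bilinear form of A_n ⊥ ℤz with Q(z) = c  (Q(x) = B(x,x)).
B : ∀ {n} (c : ℕ) → V n → V n → ℚ
B c (u , s) (v , t) = sumℚ (λ r → u r ℚ.* v r) ℚ.+ (ι (+ c) ℚ.* (s ℚ.* t))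

Q : ∀ {n} (c : ℕ) → V n → ℚ
Q c x = B c x x

glue : (n i : ℕ) → Fin (suc n) → ℚ
glue n i r =
  if toℕ r <ᵇ (suc n ∸ i)
  then (+ i) / suc n
  else ℤ.- (+ (suc n ∸ i)) / suc n

InAn : ∀ {n} → V n → Set
InAn {n} (v , s) =
  Σ (Fin (suc n) → ℤ) λ a → (sumℤ a ≡ + 0) × (∀ r → v r ≡ ι (a r)) × (s ≡ 0ℚ)

-- Membership in  A_n c[i 1/(n+1)] = (A_n ⊥ ℤz) + ℤ([i] + z/(n+1)),
-- where Q(z) = c:  elements a + p z + m([i] + z/(n+1)).
InGlued : (n c i : ℕ) → V n → Set
InGlued n c i (v , s) =
  Σ (Fin (suc n) → ℤ) λ a → Σ ℤ λ p → Σ ℤ λ m →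
    (sumℤ a ≡ + 0)
    × (∀ r → v r ≡ ι (a r) ℚ.+ (ι m ℚ.* glue n i r))
    × (s ≡ ι p ℚ.+ (ι m ℚ.* ((+ 1) / suc n)))

Integral : (n c i : ℕ) → Set
Integral n c i =
  ∀ x y → InGlued n c i x → InGlued n c i y → ∃ λ (z : ℤ) → B c x y ≡ ι z

data Span {n} (S : V n → Set) : V n → Set where
  sp-zero : Span S ((λ _ → 0ℚ) , 0ℚ)
  sp-gen  : ∀ {x} → S x → Span S x
  sp-add  : ∀ {x y} → Span S x → Span S y → Span S (x +V y)
  sp-neg  : ∀ {v s} → Span S (v , s) → Span S ((λ r → ℚ.- v r) , ℚ.- s)

RootSub : (n c i : ℕ) → V n → Set
RootSub n c i = Span (λ x → InGlued n c i x × (Q c x ℚ.≤ ι (+ 2)))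

RootSubIsAn : (n c i : ℕ) → Set
RootSubIsAn n c i = ∀ x → (RootSub n c i x → InAn x) × (InAn x → RootSub n c i x)

-- M = A_n c[i ..] is represented by L = A_n d[j ..]: there is a ℤ-linear
-- map σ : M → L with Q(σ x) = Q(x).  σ is given as a function on the ambient
-- space; only its values on M matter.  Additivity on M gives ℤ-linearity.
Represented : (n c i d j : ℕ) → Set
Represented n c i d j =
  Σ (V n → V n) λ σ →
    (∀ x → InGlued n c i x → InGlued n d j (σ x))
    × (∀ x y → InGlued n c i x → InGlued n c i y → σ (x +V y) ≈V (σ x +V σ y))
    × (∀ x → InGlued n c i x → Q d (σ x) ≡ Q c x)

{-# OPTIONS --safe #-}
-- A representation σ : X → Y preserves B, by polarisation.  It sends the roots e₀ − e_{r+1} of X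
-- to vectors of norm 2 in the root sublattice A_n of Y, i.e. to roots ±(e_a − e_b); having
-- pairwise inner product 1 these form a star ε(e_c − e_{π(r+1)}), so on A_n the map σ is ε times
-- a permutation π of the coordinates.  Hence σ z has no A_n-part, and σ([i] + z/(n+1)) has
-- centre coordinate εi/(n+1); reading off the lattice Y, the z-coefficient T of
-- (n+1)·σ([i] + z/(n+1)) is an integer with jT ≡ εi (mod n+1), and Q(σ z) = Q(z) together with
-- B(σ z, σ([i] + z/(n+1))) = B(z, [i] + z/(n+1)) give k = ℓT².  Conversely, when jt ≡ εi and
-- k = ℓt², the map x ↦ (ε x_A, t x_z) sends X into Y, since ε[i] − t[j] ∈ A_n.

module Submission where

open import Defs
open import Data.Nat using (ℕ; zero; suc; _*_; _≤_; ⌊_/2⌋)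
import Data.Nat as ℕ
import Data.Nat.Properties as ℕP
open import Data.Integer using (ℤ; +_; -[1+_]; ∣_∣)
import Data.Integer as ℤ
import Data.Integer.Properties as ℤP
import Data.Integer.Solver as ℤSolver
open import Data.Integer.Divisibility using (_∣_)
import Data.Integer.Divisibility.Signed as ℤ∣
open import Data.Rational using (ℚ; 0ℚ; 1ℚ; ½; _/_; toℚᵘ)
import Data.Rational as ℚ
import Data.Rational.Properties as ℚP
open import Data.Rational.Solver using (module +-*-Solver)
open import Data.Rational.Unnormalised using (mkℚᵘ; *≡*)
import Data.Rational.Unnormalised as ℚᵘ
import Data.Rational.Unnormalised.Properties as ℚᵘP
open import Data.Fin as Fin using (Fin; toℕ)
import Data.Fin.Properties as FinP
open import Data.Fin.Permutation using (Permutation; permutation; _⟨$⟩ʳ_)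
open import Data.Bool using (Bool; true; false; if_then_else_)
open import Data.Empty using (⊥-elim)
open import Data.Product using (Σ; _×_; _,_; proj₁; proj₂)
open import Data.Sum using (_⊎_; inj₁; inj₂)
open import Algebra.Bundles using (CommutativeRing)
import Algebra.Properties.Semiring.Sum as SemiringSum
open import Function.Bundles using (_⇔_; mk⇔)
open import Relation.Binary.PropositionalEquality
  using (_≡_; refl; sym; trans; cong; cong₂; subst; module ≡-Reasoning)
open import Relation.Nullary using (¬_; yes; no)

open +-*-Solver using (solve; _:+_; _:*_; _:-_; :-_; _:=_; con)
module ℤS = ℤSolver.+-*-Solver

ι-toℚᵘ : ∀ a → toℚᵘ (ι a) ℚᵘ.≃ mkℚᵘ a 0
ι-toℚᵘ a = ℚP.toℚᵘ-fromℚᵘ (mkℚᵘ a 0)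

≡ι-via-toℚᵘ : ∀ {p} a → toℚᵘ p ℚᵘ.≃ mkℚᵘ a 0 → p ≡ ι a
≡ι-via-toℚᵘ a h = ℚP.toℚᵘ-injective (ℚᵘP.≃-trans h (ℚᵘP.≃-sym (ι-toℚᵘ a)))

ι-+ : ∀ a b → ι (a ℤ.+ b) ≡ ι a ℚ.+ ι b
ι-+ a b = sym (≡ι-via-toℚᵘ (a ℤ.+ b) (ℚᵘP.≃-trans (ℚP.toℚᵘ-homo-+ (ι a) (ι b))
  (ℚᵘP.≃-trans (ℚᵘP.+-cong (ι-toℚᵘ a) (ι-toℚᵘ b)) (*≡* (ℤS.solve 2
    (λ a b → (a ℤS.:* ℤS.con (+ 1) ℤS.:+ b ℤS.:* ℤS.con (+ 1)) ℤS.:* ℤS.con (+ 1)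
             ℤS.:= (a ℤS.:+ b) ℤS.:* (ℤS.con (+ 1) ℤS.:* ℤS.con (+ 1))) refl a b)))))

ι-* : ∀ a b → ι (a ℤ.* b) ≡ ι a ℚ.* ι b
ι-* a b = sym (≡ι-via-toℚᵘ (a ℤ.* b) (ℚᵘP.≃-trans (ℚP.toℚᵘ-homo-* (ι a) (ι b))
  (ℚᵘP.≃-trans (ℚᵘP.*-cong (ι-toℚᵘ a) (ι-toℚᵘ b)) (*≡* (ℤS.solve 2
    (λ a b → (a ℤS.:* b) ℤS.:* ℤS.con (+ 1) ℤS.:= (a ℤS.:* b) ℤS.:* (ℤS.con (+ 1) ℤS.:* ℤS.con (+ 1)))
    refl a b)))))

ι-neg : ∀ a → ι (ℤ.- a) ≡ ℚ.- ι a
ι-neg a = sym (≡ι-via-toℚᵘ (ℤ.- a) (ℚᵘP.≃-trans (ℚP.toℚᵘ-homo‿- (ι a)) (ℚᵘP.-‿cong (ι-toℚᵘ a))))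

ι-sub : ∀ a b → ι (a ℤ.- b) ≡ ι a ℚ.- ι b
ι-sub a b = trans (ι-+ a (ℤ.- b)) (cong (ι a ℚ.+_) (ι-neg b))

ι-pos-* : ∀ a b → ι (+ (a * b)) ≡ ι (+ a) ℚ.* ι (+ b)
ι-pos-* a b = trans (cong ι (ℤP.pos-* a b)) (ι-* (+ a) (+ b))

ι-injective : ∀ {a b} → ι a ≡ ι b → a ≡ b
ι-injective {a} {b} e
  with *≡* h ← ℚᵘP.≃-trans (ℚᵘP.≃-sym (ι-toℚᵘ a)) (ℚᵘP.≃-trans (ℚP.toℚᵘ-cong e) (ι-toℚᵘ b))
  = trans (sym (ℤP.*-identityʳ a)) (trans h (ℤP.*-identityʳ b))

ω : ℕ → ℚ
ω n = + 1 / suc n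

/suc≡ι*ω : ∀ n z → z / suc n ≡ ι z ℚ.* ω n
/suc≡ι*ω n z = ℚP.toℚᵘ-injective (ℚᵘP.≃-trans (ℚP.toℚᵘ-fromℚᵘ (mkℚᵘ z n)) (ℚᵘP.≃-sym
  (ℚᵘP.≃-trans (ℚP.toℚᵘ-homo-* (ι z) (ω n))
  (ℚᵘP.≃-trans (ℚᵘP.*-cong (ι-toℚᵘ z) (ℚP.toℚᵘ-fromℚᵘ (mkℚᵘ (+ 1) n))) (*≡* (ℤS.solve 2
    (λ z d → (z ℤS.:* ℤS.con (+ 1)) ℤS.:* d ℤS.:= z ℤS.:* (ℤS.con (+ 1) ℤS.:* d)) refl z (ℤ.+[1+ n ])))))))

ι[1+n]*ω≡1 : ∀ n → ι (+ suc n) ℚ.* ω n ≡ 1ℚ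
ι[1+n]*ω≡1 n = ℚP.toℚᵘ-injective (ℚᵘP.≃-trans (ℚP.toℚᵘ-homo-* (ι (+ suc n)) (ω n))
  (ℚᵘP.≃-trans (ℚᵘP.*-cong (ι-toℚᵘ (+ suc n)) (ℚP.toℚᵘ-fromℚᵘ (mkℚᵘ (+ 1) n))) (*≡* (ℤS.solve 1
    (λ d → (d ℤS.:* ℤS.con (+ 1)) ℤS.:* ℤS.con (+ 1) ℤS.:= ℤS.con (+ 1) ℤS.:* (ℤS.con (+ 1) ℤS.:* d))
    refl (ℤ.+[1+ n ])))))

ι[1+n]*[*ω] : ∀ n a → ι (+ suc n) ℚ.* (a ℚ.* ω n) ≡ a
ι[1+n]*[*ω] n a = trans (solve 3 (λ N a w → N :* (a :* w) := a :* (N :* w)) refl (ι (+ suc n)) a (ω n))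
  (trans (cong (a ℚ.*_) (ι[1+n]*ω≡1 n)) (ℚP.*-identityʳ a))

ι[1+n]*-cancelˡ : ∀ n {a b} → ι (+ suc n) ℚ.* a ≡ ι (+ suc n) ℚ.* b → a ≡ b
ι[1+n]*-cancelˡ n {a} {b} h = begin
  a                                ≡⟨ solve 3 (λ a N w → a := (N :* a) :* w :+ (con 1ℚ :- N :* w) :* a) refl a N (ω n) ⟩
  (N ℚ.* a) ℚ.* ω n ℚ.+ (1ℚ ℚ.- N ℚ.* ω n) ℚ.* a ≡⟨ cong₂ (λ p q → p ℚ.* ω n ℚ.+ (1ℚ ℚ.- q) ℚ.* a) h (ι[1+n]*ω≡1 n) ⟩
  (N ℚ.* b) ℚ.* ω n ℚ.+ (1ℚ ℚ.- 1ℚ) ℚ.* a         ≡⟨ solve 4 (λ a b N w → (N :* b) :* w :+ (con 1ℚ :- con 1ℚ) :* a := b :* (N :* w)) refl a b N (ω n) ⟩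
  b ℚ.* (N ℚ.* ω n)                                ≡⟨ trans (cong (b ℚ.*_) (ι[1+n]*ω≡1 n)) (ℚP.*-identityʳ b) ⟩
  b                                                ∎
  where
  open ≡-Reasoning
  N = ι (+ suc n)

module ΣQ = SemiringSum (CommutativeRing.semiring ℚP.+-*-commutativeRing)

sumℚ≡sum : ∀ {m} (f : Fin m → ℚ) → sumℚ f ≡ ΣQ.sum f
sumℚ≡sum {zero}  f = refl
sumℚ≡sum {suc m} f = cong (f Fin.zero ℚ.+_) (sumℚ≡sum (λ r → f (Fin.suc r)))

sumℚ-cong : ∀ {m} {f g : Fin m → ℚ} → (∀ r → f r ≡ g r) → sumℚ f ≡ sumℚ g
sumℚ-cong {f = f} {g} h = trans (sumℚ≡sum f) (trans (ΣQ.sum-cong-≗ h) (sym (sumℚ≡sum g)))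

sumℚ-+ : ∀ {m} (f g : Fin m → ℚ) → sumℚ (λ r → f r ℚ.+ g r) ≡ sumℚ f ℚ.+ sumℚ g
sumℚ-+ f g = trans (sumℚ≡sum (λ r → f r ℚ.+ g r)) (trans (ΣQ.∑-distrib-+ f g) (sym (cong₂ ℚ._+_ (sumℚ≡sum f) (sumℚ≡sum g))))

sumℚ-*ˡ : ∀ {m} c (f : Fin m → ℚ) → sumℚ (λ r → c ℚ.* f r) ≡ c ℚ.* sumℚ f
sumℚ-*ˡ c f = trans (sumℚ≡sum (λ r → c ℚ.* f r)) (trans (sym (ΣQ.*-distribˡ-sum c f)) (cong (c ℚ.*_) (sym (sumℚ≡sum f))))

sumℚ-zero : ∀ m → sumℚ {m} (λ _ → 0ℚ) ≡ 0ℚ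
sumℚ-zero m = trans (sumℚ≡sum {m} (λ _ → 0ℚ)) (ΣQ.sum-replicate-zero m)

sumℚ-permute : ∀ {m} (f : Fin m → ℚ) (π : Permutation m m) → sumℚ f ≡ sumℚ (λ r → f (π ⟨$⟩ʳ r))
sumℚ-permute f π = trans (sumℚ≡sum f) (trans (ΣQ.sum-permute f π) (sym (sumℚ≡sum (λ r → f (π ⟨$⟩ʳ r)))))

sumℚ-- : ∀ {m} (f g : Fin m → ℚ) → sumℚ (λ r → f r ℚ.- g r) ≡ sumℚ f ℚ.- sumℚ g
sumℚ-- f g = begin
  sumℚ (λ r → f r ℚ.- g r)                   ≡⟨ sumℚ-cong (λ r → solve 2 (λ a b → a :- b := a :+ con (ℚ.- 1ℚ) :* b) refl (f r) (g r)) ⟩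
  sumℚ (λ r → f r ℚ.+ ℚ.- 1ℚ ℚ.* g r)        ≡⟨ trans (sumℚ-+ f _) (cong (sumℚ f ℚ.+_) (sumℚ-*ˡ (ℚ.- 1ℚ) g)) ⟩
  sumℚ f ℚ.+ ℚ.- 1ℚ ℚ.* sumℚ g               ≡⟨ solve 2 (λ a b → a :+ con (ℚ.- 1ℚ) :* b := a :- b) refl (sumℚ f) (sumℚ g) ⟩
  sumℚ f ℚ.- sumℚ g                          ∎
  where open ≡-Reasoning

sumℚ-const : ∀ m c → sumℚ {m} (λ _ → c) ≡ ι (+ m) ℚ.* c
sumℚ-const zero    c = sym (ℚP.*-zeroˡ c)
sumℚ-const (suc m) c = begin
  c ℚ.+ sumℚ {m} (λ _ → c)       ≡⟨ cong (c ℚ.+_) (sumℚ-const m c) ⟩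
  c ℚ.+ ι (+ m) ℚ.* c            ≡⟨ solve 2 (λ c x → c :+ x :* c := (con 1ℚ :+ x) :* c) refl c (ι (+ m)) ⟩
  (1ℚ ℚ.+ ι (+ m)) ℚ.* c         ≡⟨ cong (ℚ._* c) (sym (ι-+ (+ 1) (+ m))) ⟩
  ι (+ suc m) ℚ.* c              ∎
  where open ≡-Reasoning

sumℚ-affine : ∀ m (y e x₀ : ℚ) (f : Fin m → ℚ) →
  sumℚ (λ z → y ℚ.- e ℚ.* (x₀ ℚ.- f z)) ≡ ι (+ m) ℚ.* y ℚ.- e ℚ.* (ι (+ m) ℚ.* x₀ ℚ.- sumℚ f)
sumℚ-affine m y e x₀ f = trans (sumℚ-- (λ _ → y) (λ z → e ℚ.* (x₀ ℚ.- f z)))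
  (cong₂ ℚ._-_ (sumℚ-const m y) (trans (sumℚ-*ˡ e (λ z → x₀ ℚ.- f z))
    (cong (e ℚ.*_) (trans (sumℚ-- (λ _ → x₀) f) (cong (ℚ._- sumℚ f) (sumℚ-const m x₀))))))

ι-sumℤ : ∀ {m} (a : Fin m → ℤ) → ι (sumℤ a) ≡ sumℚ (λ r → ι (a r))
ι-sumℤ {zero}  a = refl
ι-sumℤ {suc m} a = trans (ι-+ (a Fin.zero) _) (cong (ι (a Fin.zero) ℚ.+_) (ι-sumℤ (λ r → a (Fin.suc r))))

sumℤ≡0 : ∀ {m} (a : Fin m → ℤ) → sumℚ (λ r → ι (a r)) ≡ 0ℚ → sumℤ a ≡ + 0
sumℤ≡0 a h = ι-injective (trans (ι-sumℤ a) h)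

sumℚ-threshold : ∀ m K (a b : ℚ) → K ≤ m →
  sumℚ {m} (λ r → if toℕ r ℕ.<ᵇ K then a else b) ≡ ι (+ K) ℚ.* a ℚ.+ ι (+ (m ℕ.∸ K)) ℚ.* b
sumℚ-threshold m       zero    a b _ = trans (sumℚ-const m b) (solve 3 (λ a b x → x :* b := con 0ℚ :* a :+ x :* b) refl a b (ι (+ m)))
sumℚ-threshold (suc m) (suc K) a b (ℕ.s≤s K≤m) = begin
  a ℚ.+ sumℚ {m} _                                          ≡⟨ cong (a ℚ.+_) (sumℚ-threshold m K a b K≤m) ⟩
  a ℚ.+ (ι (+ K) ℚ.* a ℚ.+ ι (+ (m ℕ.∸ K)) ℚ.* b)           ≡⟨ solve 4 (λ a b x y → a :+ (x :* a :+ y :* b) := (con 1ℚ :+ x) :* a :+ y :* b) refl a b (ι (+ K)) (ι (+ (m ℕ.∸ K))) ⟩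
  (1ℚ ℚ.+ ι (+ K)) ℚ.* a ℚ.+ ι (+ (m ℕ.∸ K)) ℚ.* b          ≡⟨ cong (λ z → z ℚ.* a ℚ.+ ι (+ (m ℕ.∸ K)) ℚ.* b) (sym (ι-+ (+ 1) (+ K))) ⟩
  ι (+ suc K) ℚ.* a ℚ.+ ι (+ (m ℕ.∸ K)) ℚ.* b               ∎
  where open ≡-Reasoning

δ : ∀ {m} → Fin m → Fin m → ℤ
δ Fin.zero    Fin.zero    = + 1
δ Fin.zero    (Fin.suc _) = + 0
δ (Fin.suc _) Fin.zero    = + 0
δ (Fin.suc a) (Fin.suc b) = δ a b

δ-refl : ∀ {m} (a : Fin m) → δ a a ≡ + 1
δ-refl Fin.zero    = refl
δ-refl (Fin.suc a) = δ-refl a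

δ-≢ : ∀ {m} {a b : Fin m} → ¬ a ≡ b → δ a b ≡ + 0
δ-≢ {a = Fin.zero}  {Fin.zero}  a≢b = ⊥-elim (a≢b refl)
δ-≢ {a = Fin.zero}  {Fin.suc b} a≢b = refl
δ-≢ {a = Fin.suc a} {Fin.zero}  a≢b = refl
δ-≢ {a = Fin.suc a} {Fin.suc b} a≢b = δ-≢ (λ a≡b → a≢b (cong Fin.suc a≡b))

sumℚ-*δ : ∀ {m} (f : Fin m → ℚ) (a : Fin m) → sumℚ (λ x → f x ℚ.* ι (δ a x)) ≡ f a
sumℚ-*δ {suc m} f Fin.zero = begin
  f Fin.zero ℚ.* 1ℚ ℚ.+ sumℚ (λ x → f (Fin.suc x) ℚ.* 0ℚ) ≡⟨ cong (f Fin.zero ℚ.* 1ℚ ℚ.+_) (trans (sumℚ-cong (λ x → ℚP.*-zeroʳ (f (Fin.suc x)))) (sumℚ-zero m)) ⟩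
  f Fin.zero ℚ.* 1ℚ ℚ.+ 0ℚ                                ≡⟨ solve 1 (λ x → x :* con 1ℚ :+ con 0ℚ := x) refl (f Fin.zero) ⟩
  f Fin.zero                                              ∎
  where open ≡-Reasoning
sumℚ-*δ f (Fin.suc a) = trans (cong (f Fin.zero ℚ.* 0ℚ ℚ.+_) (sumℚ-*δ (λ r → f (Fin.suc r)) a))
  (solve 2 (λ x y → x :* con 0ℚ :+ y := y) refl (f Fin.zero) (f (Fin.suc a)))

injective⇒surjective : ∀ {m} (π : Fin m → Fin m) → (∀ a b → π a ≡ π b → a ≡ b) → ∀ y → Σ (Fin m) λ x → π x ≡ y
injective⇒surjective {zero}  π π-inj ()
injective⇒surjective {suc m} π π-inj y with FinP.any? (λ x → π x Fin.≟ y)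
... | yes hit = hit
... | no miss = ⊥-elim (ℕP.1+n≰n (FinP.injective⇒≤ {f = π≢y} π≢y-injective))
  where
  π≢y : Fin (suc m) → Fin m
  π≢y x = Fin.punchOut {i = y} {j = π x} (λ e → miss (x , sym e))
  π≢y-injective : ∀ {a b} → π≢y a ≡ π≢y b → a ≡ b
  π≢y-injective {a} {b} e = π-inj a b (FinP.punchOut-injective (λ e′ → miss (a , sym e′)) (λ e′ → miss (b , sym e′)) e)

sumℚ-reindex : ∀ {m} (π : Fin m → Fin m) → (∀ a b → π a ≡ π b → a ≡ b) → (f : Fin m → ℚ) →
               sumℚ f ≡ sumℚ (λ x → f (π x))
sumℚ-reindex π π-inj f = sumℚ-permute f (permutation π π⁻¹ (λ y → proj₂ (onto y)) (λ x → π-inj _ _ (proj₂ (onto (π x)))))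
  where
  onto : ∀ y → Σ (Fin _) λ x → π x ≡ y
  onto = injective⇒surjective π π-inj
  π⁻¹ : Fin _ → Fin _
  π⁻¹ y = proj₁ (onto y)

inTail : (n i : ℕ) → Fin (suc n) → ℤ
inTail n i r = if toℕ r ℕ.<ᵇ (suc n ℕ.∸ i) then + 0 else + 1

glue≡ : ∀ n i → i ≤ suc n → ∀ r → glue n i r ≡ ι (+ i) ℚ.* ω n ℚ.- ι (inTail n i r)
glue≡ n i i≤1+n r = by-case (toℕ r ℕ.<ᵇ (suc n ℕ.∸ i))
  where
  open ≡-Reasoning
  j′ = suc n ℕ.∸ i
  ι[j′] : ι (+ j′) ≡ ι (+ suc n) ℚ.- ι (+ i)
  ι[j′] = trans (cong ι (trans (sym (ℤP.≤-⊖ i≤1+n)) (sym (ℤP.m-n≡m⊖n (suc n) i)))) (ι-sub (+ suc n) (+ i))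
  by-case : (b : Bool) → (if b then (+ i) / suc n else ℤ.- (+ j′) / suc n) ≡
                          ι (+ i) ℚ.* ω n ℚ.- ι (if b then + 0 else + 1)
  by-case true  = trans (/suc≡ι*ω n (+ i)) (solve 1 (λ x → x := x :- con 0ℚ) refl (ι (+ i) ℚ.* ω n))
  by-case false = begin
    ℤ.- (+ j′) / suc n                             ≡⟨ trans (/suc≡ι*ω n (ℤ.- (+ j′))) (cong (ℚ._* ω n) (ι-neg (+ j′))) ⟩
    ℚ.- ι (+ j′) ℚ.* ω n                           ≡⟨ cong (λ z → ℚ.- z ℚ.* ω n) ι[j′] ⟩
    ℚ.- (ι (+ suc n) ℚ.- ι (+ i)) ℚ.* ω n          ≡⟨ solve 3 (λ a b w → :- (a :- b) :* w := b :* w :- a :* w) refl (ι (+ suc n)) (ι (+ i)) (ω n) ⟩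
    ι (+ i) ℚ.* ω n ℚ.- ι (+ suc n) ℚ.* ω n        ≡⟨ cong (λ z → ι (+ i) ℚ.* ω n ℚ.- z) (ι[1+n]*ω≡1 n) ⟩
    ι (+ i) ℚ.* ω n ℚ.- ι (+ 1)                    ∎

glue-zero : ∀ n i → i ≤ n → glue n i Fin.zero ≡ ι (+ i) ℚ.* ω n
glue-zero n i i≤n = begin
  glue n i Fin.zero                                 ≡⟨ glue≡ n i (ℕP.m≤n⇒m≤1+n i≤n) Fin.zero ⟩
  ι (+ i) ℚ.* ω n ℚ.- ι (inTail n i Fin.zero)       ≡⟨ cong (λ b → ι (+ i) ℚ.* ω n ℚ.- ι b) inTail-zero ⟩
  ι (+ i) ℚ.* ω n ℚ.- 0ℚ                            ≡⟨ ℚP.+-identityʳ _ ⟩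
  ι (+ i) ℚ.* ω n                                   ∎
  where
  open ≡-Reasoning
  inTail-zero : inTail n i Fin.zero ≡ + 0
  inTail-zero rewrite ℕP.+-∸-assoc 1 i≤n = refl

sumℚ-glue : ∀ n i → i ≤ suc n → sumℚ (glue n i) ≡ 0ℚ
sumℚ-glue n i i≤1+n = begin
  sumℚ (glue n i)                                  ≡⟨ sumℚ-threshold (suc n) j′ _ _ (ℕP.m∸n≤m (suc n) i) ⟩
  ι (+ j′) ℚ.* (+ i / suc n) ℚ.+ ι (+ (suc n ℕ.∸ j′)) ℚ.* (ℤ.- (+ j′) / suc n)
                                                   ≡⟨ cong (λ z → ι (+ j′) ℚ.* (+ i / suc n) ℚ.+ ι (+ z) ℚ.* (ℤ.- (+ j′) / suc n)) (ℕP.m∸[m∸n]≡n i≤1+n) ⟩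
  ι (+ j′) ℚ.* (+ i / suc n) ℚ.+ ι (+ i) ℚ.* (ℤ.- (+ j′) / suc n)
                                                   ≡⟨ cong₂ (λ a b → ι (+ j′) ℚ.* a ℚ.+ ι (+ i) ℚ.* b) (/suc≡ι*ω n (+ i))
                                                        (trans (/suc≡ι*ω n (ℤ.- (+ j′))) (cong (ℚ._* ω n) (ι-neg (+ j′)))) ⟩
  ι (+ j′) ℚ.* (ι (+ i) ℚ.* ω n) ℚ.+ ι (+ i) ℚ.* (ℚ.- ι (+ j′) ℚ.* ω n)
                                                   ≡⟨ solve 3 (λ x y w → x :* (y :* w) :+ y :* (:- x :* w) := con 0ℚ) refl (ι (+ j′)) (ι (+ i)) (ω n) ⟩
  0ℚ                                               ∎
  where
  open ≡-Reasoning
  j′ = suc n ℕ.∸ i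

≈V-sym : ∀ {n} {x y : V n} → x ≈V y → y ≈V x
≈V-sym (coords , z) = (λ r → sym (coords r)) , sym z

≈V-trans : ∀ {n} {x y z : V n} → x ≈V y → y ≈V z → x ≈V z
≈V-trans (cxy , zxy) (cyz , zyz) = (λ r → trans (cxy r) (cyz r)) , trans zxy zyz

B-cong : ∀ {n} c {x x′ y y′ : V n} → x ≈V x′ → y ≈V y′ → B c x y ≡ B c x′ y′
B-cong c (ex , ez) (fx , fz) =
  cong₂ ℚ._+_ (sumℚ-cong (λ r → cong₂ ℚ._*_ (ex r) (fx r))) (cong (ι (+ c) ℚ.*_) (cong₂ ℚ._*_ ez fz))

B≡polar : ∀ {n} c (x y : V n) → B c x y ≡ ½ ℚ.* (Q c (x +V y) ℚ.- Q c x ℚ.- Q c y)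
B≡polar c (u , s) (v , t) = begin
  Suv ℚ.+ C ℚ.* (s ℚ.* t)                   ≡⟨ solve 6 (λ a b d C s t → b :+ C :* (s :* t) := con ½ :* ((a :+ (b :+ b) :+ d :+ C :* ((s :+ t) :* (s :+ t)))
                                                  :- (a :+ C :* (s :* s)) :- (d :+ C :* (t :* t)))) refl Suu Suv Svv C s t ⟩
  ½ ℚ.* ((Suu ℚ.+ (Suv ℚ.+ Suv) ℚ.+ Svv) ℚ.+ C ℚ.* ((s ℚ.+ t) ℚ.* (s ℚ.+ t)) ℚ.- Q c (u , s) ℚ.- Q c (v , t))
                                            ≡⟨ cong (λ S → ½ ℚ.* (S ℚ.+ C ℚ.* ((s ℚ.+ t) ℚ.* (s ℚ.+ t)) ℚ.- Q c (u , s) ℚ.- Q c (v , t))) (sym square-sum) ⟩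
  ½ ℚ.* (Q c ((u , s) +V (v , t)) ℚ.- Q c (u , s) ℚ.- Q c (v , t)) ∎
  where
  open ≡-Reasoning
  C = ι (+ c)
  Suu = sumℚ (λ r → u r ℚ.* u r)
  Suv = sumℚ (λ r → u r ℚ.* v r)
  Svv = sumℚ (λ r → v r ℚ.* v r)
  square-sum : sumℚ (λ r → (u r ℚ.+ v r) ℚ.* (u r ℚ.+ v r)) ≡ Suu ℚ.+ (Suv ℚ.+ Suv) ℚ.+ Svv
  square-sum = trans (sumℚ-cong (λ r → solve 2 (λ a b → (a :+ b) :* (a :+ b) := (a :* a :+ (a :* b :+ a :* b)) :+ b :* b) refl (u r) (v r)))
    (trans (sumℚ-+ (λ r → u r ℚ.* u r ℚ.+ (u r ℚ.* v r ℚ.+ u r ℚ.* v r)) (λ r → v r ℚ.* v r))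
      (cong (ℚ._+ Svv) (trans (sumℚ-+ (λ r → u r ℚ.* u r) (λ r → u r ℚ.* v r ℚ.+ u r ℚ.* v r))
      (cong (Suu ℚ.+_) (sumℚ-+ (λ r → u r ℚ.* v r) (λ r → u r ℚ.* v r))))))

B-preserved : ∀ {n} c d (P : V n → Set) (σ : V n → V n) →
  (∀ {x y} → P x → P y → P (x +V y)) →
  (∀ x y → P x → P y → σ (x +V y) ≈V (σ x +V σ y)) →
  (∀ x → P x → Q d (σ x) ≡ Q c x) →
  ∀ x y → P x → P y → B d (σ x) (σ y) ≡ B c x y
B-preserved c d P σ P-+ σ-+ σ-Q x y Px Py = begin
  B d (σ x) (σ y)                                           ≡⟨ B≡polar d (σ x) (σ y) ⟩
  ½ ℚ.* (Q d (σ x +V σ y) ℚ.- Q d (σ x) ℚ.- Q d (σ y))      ≡⟨ cong (λ q → ½ ℚ.* (q ℚ.- Q d (σ x) ℚ.- Q d (σ y))) (B-cong d σ[x+y]≈ σ[x+y]≈) ⟩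
  ½ ℚ.* (Q d (σ (x +V y)) ℚ.- Q d (σ x) ℚ.- Q d (σ y))      ≡⟨ cong₂ (λ p q → ½ ℚ.* (p ℚ.- q ℚ.- Q d (σ y))) (σ-Q (x +V y) (P-+ Px Py)) (σ-Q x Px) ⟩
  ½ ℚ.* (Q c (x +V y) ℚ.- Q c x ℚ.- Q d (σ y))              ≡⟨ cong (λ q → ½ ℚ.* (Q c (x +V y) ℚ.- Q c x ℚ.- q)) (σ-Q y Py) ⟩
  ½ ℚ.* (Q c (x +V y) ℚ.- Q c x ℚ.- Q c y)                  ≡⟨ sym (B≡polar c x y) ⟩
  B c x y                                                   ∎
  where
  open ≡-Reasoning
  σ[x+y]≈ : (σ x +V σ y) ≈V σ (x +V y)
  σ[x+y]≈ = ≈V-sym (σ-+ x y Px Py)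

B-A-free : ∀ {n} c (u v : Fin (suc n) → ℚ) s t → (∀ r → u r ≡ 0ℚ) → B c (u , s) (v , t) ≡ ι (+ c) ℚ.* (s ℚ.* t)
B-A-free {n} c u v s t u≡0 = trans (cong (ℚ._+ ι (+ c) ℚ.* (s ℚ.* t))
  (trans (sumℚ-cong (λ r → trans (cong (ℚ._* v r) (u≡0 r)) (ℚP.*-zeroˡ (v r)))) (sumℚ-zero (suc n)))) (ℚP.+-identityˡ _)

root : ∀ {n} → ℚ → Fin (suc n) → Fin (suc n) → V n
root e a b = (λ x → e ℚ.* (ι (δ a x) ℚ.- ι (δ b x))) , 0ℚ

B-root : ∀ {n} c (u : Fin (suc n) → ℚ) s e a b → B c (u , s) (root e a b) ≡ e ℚ.* (u a ℚ.- u b)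
B-root c u s e a b = begin
  sumℚ (λ x → u x ℚ.* (e ℚ.* (ι (δ a x) ℚ.- ι (δ b x)))) ℚ.+ ι (+ c) ℚ.* (s ℚ.* 0ℚ)
      ≡⟨ cong₂ ℚ._+_ (sumℚ-cong (λ x → solve 4 (λ U E p q → U :* (E :* (p :- q)) := E :* (U :* p :- U :* q)) refl (u x) e (ι (δ a x)) (ι (δ b x))))
                     (solve 2 (λ C s → C :* (s :* con 0ℚ) := con 0ℚ) refl (ι (+ c)) s) ⟩
  sumℚ (λ x → e ℚ.* (u x ℚ.* ι (δ a x) ℚ.- u x ℚ.* ι (δ b x))) ℚ.+ 0ℚ
      ≡⟨ trans (ℚP.+-identityʳ _) (sumℚ-*ˡ e (λ x → u x ℚ.* ι (δ a x) ℚ.- u x ℚ.* ι (δ b x))) ⟩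
  e ℚ.* sumℚ (λ x → u x ℚ.* ι (δ a x) ℚ.- u x ℚ.* ι (δ b x))
      ≡⟨ cong (e ℚ.*_) (trans (sumℚ-- (λ x → u x ℚ.* ι (δ a x)) (λ x → u x ℚ.* ι (δ b x)))
                              (cong₂ ℚ._-_ (sumℚ-*δ u a) (sumℚ-*δ u b))) ⟩
  e ℚ.* (u a ℚ.- u b) ∎
  where open ≡-Reasoning

sumℚ-root : ∀ {n} e (a b : Fin (suc n)) → sumℚ (proj₁ (root e a b)) ≡ 0ℚ
sumℚ-root e a b = begin
  sumℚ (λ x → e ℚ.* (ι (δ a x) ℚ.- ι (δ b x)))        ≡⟨ trans (sumℚ-*ˡ e (λ x → ι (δ a x) ℚ.- ι (δ b x)))
                                                               (cong (e ℚ.*_) (sumℚ-- (λ x → ι (δ a x)) (λ x → ι (δ b x)))) ⟩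
  e ℚ.* (sumℚ (λ x → ι (δ a x)) ℚ.- sumℚ (λ x → ι (δ b x))) ≡⟨ cong (λ z → e ℚ.* z) (cong₂ ℚ._-_ (sumℚ-δ a) (sumℚ-δ b)) ⟩
  e ℚ.* (1ℚ ℚ.- 1ℚ)                                    ≡⟨ ℚP.*-zeroʳ e ⟩
  0ℚ                                                   ∎
  where
  open ≡-Reasoning
  sumℚ-δ : ∀ a → sumℚ (λ x → ι (δ a x)) ≡ 1ℚ
  sumℚ-δ a = trans (sumℚ-cong {f = λ x → ι (δ a x)} (λ x → sym (ℚP.*-identityˡ _))) (sumℚ-*δ (λ _ → 1ℚ) a)

root-InGlued : ∀ n c i (a b : Fin (suc n)) → InGlued n c i (root 1ℚ a b)
root-InGlued n c i a b = (λ x → δ a x ℤ.- δ b x) , + 0 , + 0 ,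
  sumℤ≡0 (λ x → δ a x ℤ.- δ b x) (trans (sumℚ-cong (λ x → trans (ι-sub (δ a x) (δ b x)) (sym (ℚP.*-identityˡ _)))) (sumℚ-root 1ℚ a b)) ,
  (λ x → trans (ℚP.*-identityˡ _) (sym (trans (cong₂ ℚ._+_ (ι-sub (δ a x) (δ b x)) (ℚP.*-zeroˡ (glue n i x)))
                                        (ℚP.+-identityʳ (ι (δ a x) ℚ.- ι (δ b x)))))) ,
  sym (cong (0ℚ ℚ.+_) (ℚP.*-zeroˡ (ω n)))

InGlued-+ : ∀ n c i {x y} → InGlued n c i x → InGlued n c i y → InGlued n c i (x +V y)
InGlued-+ n c i (a , p , m , Σa≡0 , x≡ , s≡) (a′ , p′ , m′ , Σa′≡0 , x′≡ , s′≡) =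
  (λ r → a r ℤ.+ a′ r) , p ℤ.+ p′ , m ℤ.+ m′ ,
  sumℤ≡0 (λ r → a r ℤ.+ a′ r) (begin
    sumℚ (λ r → ι (a r ℤ.+ a′ r))            ≡⟨ trans (sumℚ-cong (λ r → ι-+ (a r) (a′ r))) (sumℚ-+ (λ r → ι (a r)) (λ r → ι (a′ r))) ⟩
    sumℚ (λ r → ι (a r)) ℚ.+ sumℚ (λ r → ι (a′ r)) ≡⟨ cong₂ ℚ._+_ (trans (sym (ι-sumℤ a)) (cong ι Σa≡0)) (trans (sym (ι-sumℤ a′)) (cong ι Σa′≡0)) ⟩
    0ℚ                                       ∎) ,
  (λ r → trans (cong₂ ℚ._+_ (x≡ r) (x′≡ r)) (gather (a r) (a′ r) (glue n i r))) ,
  trans (cong₂ ℚ._+_ s≡ s′≡) (gather p p′ (ω n))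
  where
  open ≡-Reasoning
  gather : ∀ b b′ g → (ι b ℚ.+ ι m ℚ.* g) ℚ.+ (ι b′ ℚ.+ ι m′ ℚ.* g) ≡ ι (b ℤ.+ b′) ℚ.+ ι (m ℤ.+ m′) ℚ.* g
  gather b b′ g = trans (solve 5 (λ B B′ M M′ g → (B :+ M :* g) :+ (B′ :+ M′ :* g) := (B :+ B′) :+ (M :+ M′) :* g) refl (ι b) (ι b′) (ι m) (ι m′) g)
    (sym (cong₂ (λ u w → u ℚ.+ w ℚ.* g) (ι-+ b b′) (ι-+ m m′)))

InGlued⇒sumℚ≡0 : ∀ n c i {v s} → i ≤ suc n → InGlued n c i (v , s) → sumℚ v ≡ 0ℚ
InGlued⇒sumℚ≡0 n c i {v} i≤1+n (a , p , m , Σa≡0 , v≡ , _) = begin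
  sumℚ v                                                  ≡⟨ trans (sumℚ-cong v≡) (sumℚ-+ (λ r → ι (a r)) (λ r → ι m ℚ.* glue n i r)) ⟩
  sumℚ (λ r → ι (a r)) ℚ.+ sumℚ (λ r → ι m ℚ.* glue n i r) ≡⟨ cong₂ ℚ._+_ (trans (sym (ι-sumℤ a)) (cong ι Σa≡0))
                                                                        (trans (sumℚ-*ˡ (ι m) (glue n i)) (cong (ι m ℚ.*_) (sumℚ-glue n i i≤1+n))) ⟩
  0ℚ ℚ.+ ι m ℚ.* 0ℚ                                       ≡⟨ solve 1 (λ M → con 0ℚ :+ M :* con 0ℚ := con 0ℚ) refl (ι m) ⟩
  0ℚ                                                      ∎
  where open ≡-Reasoning

z-InGlued : ∀ n c i → InGlued n c i ((λ _ → 0ℚ) , 1ℚ)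
z-InGlued n c i = (λ _ → + 0) , + 1 , + 0 , sumℤ≡0 {suc n} (λ _ → + 0) (sumℚ-zero (suc n)) ,
  (λ r → sym (trans (ℚP.+-identityˡ _) (ℚP.*-zeroˡ (glue n i r)))) , sym (trans (cong (1ℚ ℚ.+_) (ℚP.*-zeroˡ (ω n))) (ℚP.+-identityʳ 1ℚ))

glue-InGlued : ∀ n c i → InGlued n c i (glue n i , ω n)
glue-InGlued n c i = (λ _ → + 0) , + 0 , + 1 , sumℤ≡0 {suc n} (λ _ → + 0) (sumℚ-zero (suc n)) ,
  (λ r → sym (trans (ℚP.+-identityˡ _) (ℚP.*-identityˡ (glue n i r)))) , sym (trans (ℚP.+-identityˡ _) (ℚP.*-identityˡ (ω n)))

ι[1+n]*glued-coord : ∀ n j (a m : ℤ) {y} r → j ≤ suc n → y ≡ ι a ℚ.+ ι m ℚ.* glue n j r →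
  ι (+ suc n) ℚ.* y ≡ ι (+ suc n ℤ.* (a ℤ.- m ℤ.* inTail n j r) ℤ.+ m ℤ.* + j)
ι[1+n]*glued-coord n j a m {y} r j≤1+n y≡ = begin
  N ℚ.* y                                                      ≡⟨ cong (N ℚ.*_) (trans y≡ (cong (λ g → ι a ℚ.+ ι m ℚ.* g) (glue≡ n j j≤1+n r))) ⟩
  N ℚ.* (ι a ℚ.+ ι m ℚ.* (ι (+ j) ℚ.* ω n ℚ.- ι b))            ≡⟨ solve 6 (λ N a m J w b → N :* (a :+ m :* (J :* w :- b)) := N :* (a :- m :* b) :+ N :* ((m :* J) :* w))
                                                                     refl N (ι a) (ι m) (ι (+ j)) (ω n) (ι b) ⟩
  N ℚ.* (ι a ℚ.- ι m ℚ.* ι b) ℚ.+ N ℚ.* ((ι m ℚ.* ι (+ j)) ℚ.* ω n) ≡⟨ cong (N ℚ.* (ι a ℚ.- ι m ℚ.* ι b) ℚ.+_) (ι[1+n]*[*ω] n (ι m ℚ.* ι (+ j))) ⟩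
  N ℚ.* (ι a ℚ.- ι m ℚ.* ι b) ℚ.+ ι m ℚ.* ι (+ j)              ≡⟨ sym (trans (ι-+ (+ suc n ℤ.* (a ℤ.- m ℤ.* b)) (m ℤ.* + j)) (cong₂ ℚ._+_
                                                                     (trans (ι-* (+ suc n) (a ℤ.- m ℤ.* b)) (cong (N ℚ.*_) (trans (ι-sub a (m ℤ.* b)) (cong (λ z → ι a ℚ.- z) (ι-* m b)))))
                                                                     (ι-* m (+ j)))) ⟩
  ι (+ suc n ℤ.* (a ℤ.- m ℤ.* b) ℤ.+ m ℤ.* + j)                ∎
  where
  open ≡-Reasoning
  N = ι (+ suc n)
  b = inTail n j r

ι[1+n]*glued-zcoord : ∀ n (p m : ℤ) {s} → s ≡ ι p ℚ.+ ι m ℚ.* ω n → ι (+ suc n) ℚ.* s ≡ ι (+ suc n ℤ.* p ℤ.+ m)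
ι[1+n]*glued-zcoord n p m {s} s≡ = begin
  N ℚ.* s                             ≡⟨ cong (N ℚ.*_) s≡ ⟩
  N ℚ.* (ι p ℚ.+ ι m ℚ.* ω n)         ≡⟨ trans (ℚP.*-distribˡ-+ N (ι p) (ι m ℚ.* ω n)) (cong (N ℚ.* ι p ℚ.+_) (ι[1+n]*[*ω] n (ι m))) ⟩
  N ℚ.* ι p ℚ.+ ι m                   ≡⟨ sym (trans (ι-+ (+ suc n ℤ.* p) m) (cong (ℚ._+ ι m) (ι-* (+ suc n) p))) ⟩
  ι (+ suc n ℤ.* p ℤ.+ m)             ∎
  where
  open ≡-Reasoning
  N = ι (+ suc n)

-- Vectors of norm 2 in A_n

sumSq : ∀ {m} → (Fin m → ℤ) → ℕ
sumSq {zero}  u = 0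
sumSq {suc m} u = ∣ u Fin.zero ∣ * ∣ u Fin.zero ∣ ℕ.+ sumSq (λ r → u (Fin.suc r))

i*i≡+∣i∣*∣i∣ : ∀ i → i ℤ.* i ≡ + (∣ i ∣ * ∣ i ∣)
i*i≡+∣i∣*∣i∣ (+ m)    = sym (ℤP.pos-* m m)
i*i≡+∣i∣*∣i∣ -[1+ m ] = refl

sumℚ-squares : ∀ {m} (u : Fin m → ℤ) → sumℚ (λ r → ι (u r) ℚ.* ι (u r)) ≡ ι (+ sumSq u)
sumℚ-squares {zero}  u = refl
sumℚ-squares {suc m} u = begin
  ι u₀ ℚ.* ι u₀ ℚ.+ sumℚ (λ r → ι (u (Fin.suc r)) ℚ.* ι (u (Fin.suc r)))
      ≡⟨ cong₂ ℚ._+_ (trans (sym (ι-* u₀ u₀)) (cong ι (i*i≡+∣i∣*∣i∣ u₀))) (sumℚ-squares (λ r → u (Fin.suc r))) ⟩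
  ι (+ (∣ u₀ ∣ * ∣ u₀ ∣)) ℚ.+ ι (+ sumSq (λ r → u (Fin.suc r)))
      ≡⟨ sym (ι-+ (+ (∣ u₀ ∣ * ∣ u₀ ∣)) (+ sumSq (λ r → u (Fin.suc r)))) ⟩
  ι (+ sumSq u) ∎
  where
  open ≡-Reasoning
  u₀ = u Fin.zero

IsSign : ℤ → Set
IsSign v = v ≡ + 1 ⊎ v ≡ -[1+ 0 ]

IsSign⇒ι²≡1 : ∀ {v} → IsSign v → ι v ℚ.* ι v ≡ 1ℚ
IsSign⇒ι²≡1 (inj₁ refl) = refl
IsSign⇒ι²≡1 (inj₂ refl) = refl

head²+s≡0 : ∀ v s → ∣ v ∣ * ∣ v ∣ ℕ.+ s ≡ 0 → v ≡ + 0 × s ≡ 0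
head²+s≡0 (+ zero)  s h = refl , h
head²+s≡0 (+ suc _) s ()
head²+s≡0 -[1+ _ ]  s ()

head²+s≡1 : ∀ v s → ∣ v ∣ * ∣ v ∣ ℕ.+ s ≡ 1 → (v ≡ + 0 × s ≡ 1) ⊎ (IsSign v × s ≡ 0)
head²+s≡1 (+ zero)        s h = inj₁ (refl , h)
head²+s≡1 (+ suc zero)    s h = inj₂ (inj₁ refl , ℕP.suc-injective h)
head²+s≡1 -[1+ zero ]     s h = inj₂ (inj₂ refl , ℕP.suc-injective h)
head²+s≡1 (+ suc (suc _)) s ()
head²+s≡1 -[1+ suc _ ]    s ()

head²+s≡2 : ∀ v s → ∣ v ∣ * ∣ v ∣ ℕ.+ s ≡ 2 → (v ≡ + 0 × s ≡ 2) ⊎ (IsSign v × s ≡ 1)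
head²+s≡2 (+ zero)              s h = inj₁ (refl , h)
head²+s≡2 (+ suc zero)          s h = inj₂ (inj₁ refl , ℕP.suc-injective h)
head²+s≡2 -[1+ zero ]           s h = inj₂ (inj₂ refl , ℕP.suc-injective h)
head²+s≡2 (+ suc (suc zero))    s ()
head²+s≡2 (+ suc (suc (suc _))) s ()
head²+s≡2 -[1+ suc zero ]       s ()
head²+s≡2 -[1+ suc (suc _) ]    s ()

sumSq≡0⇒≡0 : ∀ {m} (u : Fin m → ℤ) → sumSq u ≡ 0 → ∀ x → u x ≡ + 0
sumSq≡0⇒≡0 u h Fin.zero    = proj₁ (head²+s≡0 (u Fin.zero) _ h)
sumSq≡0⇒≡0 u h (Fin.suc x) = sumSq≡0⇒≡0 (λ r → u (Fin.suc r)) (proj₂ (head²+s≡0 (u Fin.zero) _ h)) x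

sumSq≡1⇒single : ∀ {m} (u : Fin m → ℤ) → sumSq u ≡ 1 →
  Σ (Fin m) λ a → IsSign (u a) × (∀ x → ¬ x ≡ a → u x ≡ + 0)
sumSq≡1⇒single {suc m} u h with head²+s≡1 (u Fin.zero) _ h
... | inj₂ (±u₀ , rest) = Fin.zero , ±u₀ , λ
  { Fin.zero    x≢0 → ⊥-elim (x≢0 refl)
  ; (Fin.suc x) _   → sumSq≡0⇒≡0 (λ r → u (Fin.suc r)) rest x }
... | inj₁ (u₀≡0 , rest) with sumSq≡1⇒single (λ r → u (Fin.suc r)) rest
...   | a , ±ua , off = Fin.suc a , ±ua , λ
  { Fin.zero    _   → u₀≡0
  ; (Fin.suc x) x≢a → off x (λ e → x≢a (cong Fin.suc e)) }

sumSq≡2⇒double : ∀ {m} (u : Fin m → ℤ) → sumSq u ≡ 2 →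
  Σ (Fin m) λ a → Σ (Fin m) λ b → ¬ a ≡ b × IsSign (u a) × IsSign (u b) × (∀ x → ¬ x ≡ a → ¬ x ≡ b → u x ≡ + 0)
sumSq≡2⇒double {suc m} u h with head²+s≡2 (u Fin.zero) _ h
... | inj₂ (±u₀ , rest) with sumSq≡1⇒single (λ r → u (Fin.suc r)) rest
...   | b , ±ub , off = Fin.zero , Fin.suc b , (λ ()) , ±u₀ , ±ub , λ
  { Fin.zero    x≢0 _   → ⊥-elim (x≢0 refl)
  ; (Fin.suc x) _   x≢b → off x (λ e → x≢b (cong Fin.suc e)) }
sumSq≡2⇒double {suc m} u h | inj₁ (u₀≡0 , rest) with sumSq≡2⇒double (λ r → u (Fin.suc r)) rest
...   | a , b , a≢b , ±ua , ±ub , off = Fin.suc a , Fin.suc b , (λ e → a≢b (FinP.suc-injective e)) , ±ua , ±ub , λ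
  { Fin.zero    _   _   → u₀≡0
  ; (Fin.suc x) x≢a x≢b → off x (λ e → x≢a (cong Fin.suc e)) (λ e → x≢b (cong Fin.suc e)) }

norm2⇒root : ∀ {m} (u : Fin m → ℤ) → sumℤ u ≡ + 0 → sumSq u ≡ 2 →
  Σ (Fin m) λ a → Σ (Fin m) λ b → ¬ a ≡ b × (∀ x → u x ≡ δ a x ℤ.- δ b x)
norm2⇒root u Σu≡0 Σu²≡2 with sumSq≡2⇒double u Σu²≡2
... | a , b , a≢b , ±ua , ±ub , off = by-signs ±ua ±ub
  where
  open ≡-Reasoning
  two-point : ∀ x → u x ≡ u a ℤ.* δ a x ℤ.+ u b ℤ.* δ b x
  two-point x with x Fin.≟ a | x Fin.≟ b
  ... | yes refl | _ rewrite δ-refl x | δ-≢ (λ e → a≢b (sym e)) =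
    ℤS.solve 2 (λ p q → p ℤS.:= p ℤS.:* ℤS.con (+ 1) ℤS.:+ q ℤS.:* ℤS.con (+ 0)) refl (u x) (u b)
  ... | no _ | yes refl rewrite δ-refl x | δ-≢ a≢b =
    ℤS.solve 2 (λ p q → q ℤS.:= p ℤS.:* ℤS.con (+ 0) ℤS.:+ q ℤS.:* ℤS.con (+ 1)) refl (u a) (u x)
  ... | no x≢a | no x≢b rewrite δ-≢ (λ e → x≢a (sym e)) | δ-≢ (λ e → x≢b (sym e)) | off x x≢a x≢b =
    ℤS.solve 2 (λ p q → ℤS.con (+ 0) ℤS.:= p ℤS.:* ℤS.con (+ 0) ℤS.:+ q ℤS.:* ℤS.con (+ 0)) refl (u a) (u b)
  ua+ub≡0 : u a ℤ.+ u b ≡ + 0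
  ua+ub≡0 = ι-injective (begin
    ι (u a ℤ.+ u b)                         ≡⟨ ι-+ (u a) (u b) ⟩
    ι (u a) ℚ.+ ι (u b)                     ≡⟨ sym (cong₂ ℚ._+_ (sumℚ-*δ (λ _ → ι (u a)) a) (sumℚ-*δ (λ _ → ι (u b)) b)) ⟩
    sumℚ (λ x → ι (u a) ℚ.* ι (δ a x)) ℚ.+ sumℚ (λ x → ι (u b) ℚ.* ι (δ b x))
                                            ≡⟨ sym (sumℚ-+ (λ x → ι (u a) ℚ.* ι (δ a x)) (λ x → ι (u b) ℚ.* ι (δ b x))) ⟩
    sumℚ (λ x → ι (u a) ℚ.* ι (δ a x) ℚ.+ ι (u b) ℚ.* ι (δ b x))
                                            ≡⟨ sumℚ-cong (λ x → sym (trans (cong ι (two-point x)) (trans (ι-+ (u a ℤ.* δ a x) (u b ℤ.* δ b x))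
                                                 (cong₂ ℚ._+_ (ι-* (u a) (δ a x)) (ι-* (u b) (δ b x)))))) ⟩
    sumℚ (λ x → ι (u x))                    ≡⟨ trans (sym (ι-sumℤ u)) (cong ι Σu≡0) ⟩
    ι (+ 0)                                 ∎)
  signed : ∀ ea eb → u a ≡ ea → u b ≡ eb → ∀ x → u x ≡ ea ℤ.* δ a x ℤ.+ eb ℤ.* δ b x
  signed ea eb refl refl = two-point
  by-signs : IsSign (u a) → IsSign (u b) → Σ _ λ α → Σ _ λ β → ¬ α ≡ β × (∀ x → u x ≡ δ α x ℤ.- δ β x)
  by-signs (inj₁ ua≡1) (inj₂ ub≡-1) = a , b , a≢b , λ x → trans (signed _ _ ua≡1 ub≡-1 x)
    (ℤS.solve 2 (λ p q → ℤS.con (+ 1) ℤS.:* p ℤS.:+ ℤS.con -[1+ 0 ] ℤS.:* q ℤS.:= p ℤS.:- q) refl (δ a x) (δ b x))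
  by-signs (inj₂ ua≡-1) (inj₁ ub≡1) = b , a , (λ e → a≢b (sym e)) , λ x → trans (signed _ _ ua≡-1 ub≡1 x)
    (ℤS.solve 2 (λ p q → ℤS.con -[1+ 0 ] ℤS.:* p ℤS.:+ ℤS.con (+ 1) ℤS.:* q ℤS.:= q ℤS.:- p) refl (δ a x) (δ b x))
  by-signs (inj₁ ua≡1)  (inj₁ ub≡1)  with () ← trans (sym (cong₂ ℤ._+_ ua≡1 ub≡1)) ua+ub≡0
  by-signs (inj₂ ua≡-1) (inj₂ ub≡-1) with () ← trans (sym (cong₂ ℤ._+_ ua≡-1 ub≡-1)) ua+ub≡0

Q-ofℤ : ∀ {n} c {v s} (u : Fin (suc n) → ℤ) → (∀ r → v r ≡ ι (u r)) → s ≡ 0ℚ → Q c (v , s) ≡ ι (+ sumSq u)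
Q-ofℤ c {v} {s} u v≡ s≡0 = begin
  sumℚ (λ r → v r ℚ.* v r) ℚ.+ ι (+ c) ℚ.* (s ℚ.* s) ≡⟨ cong (sumℚ (λ r → v r ℚ.* v r) ℚ.+_) (trans (cong (λ z → ι (+ c) ℚ.* (z ℚ.* z)) s≡0) (ℚP.*-zeroʳ (ι (+ c)))) ⟩
  sumℚ (λ r → v r ℚ.* v r) ℚ.+ 0ℚ                      ≡⟨ trans (ℚP.+-identityʳ _) (sumℚ-cong (λ r → cong₂ ℚ._*_ (v≡ r) (v≡ r))) ⟩
  sumℚ (λ r → ι (u r) ℚ.* ι (u r))                     ≡⟨ sumℚ-squares u ⟩
  ι (+ sumSq u)                                        ∎
  where open ≡-Reasoning

InAn-norm2⇒root : ∀ {n} c {x : V n} → InAn x → Q c x ≡ ι (+ 2) →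
  Σ (Fin (suc n)) λ a → Σ (Fin (suc n)) λ b → ¬ a ≡ b × x ≈V root 1ℚ a b
InAn-norm2⇒root c {v , s} (u , Σu≡0 , v≡ , s≡0) Qx≡2 = root-of (norm2⇒root u Σu≡0 Σu²≡2)
  where
  Σu²≡2 : sumSq u ≡ 2
  Σu²≡2 = ℤP.+-injective (ι-injective {+ sumSq u} {+ 2} (trans (sym (Q-ofℤ c u v≡ s≡0)) Qx≡2))
  root-of : (Σ _ λ a → Σ _ λ b → ¬ a ≡ b × (∀ x → u x ≡ δ a x ℤ.- δ b x)) →
            Σ _ λ a → Σ _ λ b → ¬ a ≡ b × (v , s) ≈V root 1ℚ a b
  root-of (a , b , a≢b , u≡) = a , b , a≢b , (λ x → trans (v≡ x) (trans (cong ι (u≡ x))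
    (trans (ι-sub (δ a x) (δ b x)) (sym (ℚP.*-identityˡ (ι (δ a x) ℚ.- ι (δ b x))))))) , s≡0

-- Families of roots with pairwise inner product 1

rootProduct : ∀ {m} → Fin m → Fin m → Fin m → Fin m → ℤ
rootProduct a b c d = (δ a c ℤ.- δ b c) ℤ.- (δ a d ℤ.- δ b d)

B-root-root : ∀ {n} k (a b c d : Fin (suc n)) → B k (root 1ℚ a b) (root 1ℚ c d) ≡ ι (rootProduct a b c d)
B-root-root k a b c d = begin
  B k (root 1ℚ a b) (root 1ℚ c d)                            ≡⟨ B-root k (proj₁ (root 1ℚ a b)) 0ℚ 1ℚ c d ⟩
  1ℚ ℚ.* (1ℚ ℚ.* (ι (δ a c) ℚ.- ι (δ b c)) ℚ.- 1ℚ ℚ.* (ι (δ a d) ℚ.- ι (δ b d)))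
                                                             ≡⟨ solve 4 (λ p q r s → con 1ℚ :* (con 1ℚ :* (p :- q) :- con 1ℚ :* (r :- s)) := (p :- q) :- (r :- s)) refl (ι (δ a c)) (ι (δ b c)) (ι (δ a d)) (ι (δ b d)) ⟩
  (ι (δ a c) ℚ.- ι (δ b c)) ℚ.- (ι (δ a d) ℚ.- ι (δ b d))    ≡⟨ sym (trans (ι-sub (δ a c ℤ.- δ b c) (δ a d ℤ.- δ b d)) (cong₂ ℚ._-_ (ι-sub (δ a c) (δ b c)) (ι-sub (δ a d) (δ b d)))) ⟩
  ι (rootProduct a b c d)                                    ∎
  where open ≡-Reasoning

rootProduct-swap : ∀ {m} (a b c d : Fin m) → rootProduct b a d c ≡ rootProduct a b c d
rootProduct-swap a b c d =
  ℤS.solve 4 (λ p q r s → (p ℤS.:- q) ℤS.:- (r ℤS.:- s) ℤS.:= (s ℤS.:- r) ℤS.:- (q ℤS.:- p)) refl (δ b d) (δ a d) (δ b c) (δ a c)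

δ∈01 : ∀ {m} (a b : Fin m) → δ a b ≡ + 0 ⊎ δ a b ≡ + 1
δ∈01 a b with a Fin.≟ b
... | yes refl = inj₂ (δ-refl a)
... | no a≢b   = inj₁ (δ-≢ a≢b)

rootProduct≡1 : ∀ {m} (a b c d : Fin m) → ¬ a ≡ b → rootProduct a b c d ≡ + 1 →
  (a ≡ c × ¬ b ≡ d) ⊎ (b ≡ d × ¬ a ≡ c)
rootProduct≡1 a b c d a≢b h with a Fin.≟ c | b Fin.≟ d
... | yes refl | no b≢d   = inj₁ (refl , b≢d)
... | no a≢c   | yes refl = inj₂ (refl , a≢c)
... | yes refl | yes refl rewrite δ-refl a | δ-refl b | δ-≢ a≢b | δ-≢ (λ e → a≢b (sym e)) with () ← h
... | no a≢c   | no b≢d   rewrite δ-≢ a≢c | δ-≢ b≢d = impossible (δ∈01 b c) (δ∈01 a d) h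
  where
  impossible : ∀ {x y} → x ≡ + 0 ⊎ x ≡ + 1 → y ≡ + 0 ⊎ y ≡ + 1 → (+ 0 ℤ.- x) ℤ.- (y ℤ.- + 0) ≡ + 1 →
               (a ≡ c × ¬ b ≡ d) ⊎ (b ≡ d × ¬ a ≡ c)
  impossible (inj₁ refl) (inj₁ refl) ()
  impossible (inj₁ refl) (inj₂ refl) ()
  impossible (inj₂ refl) (inj₁ refl) ()
  impossible (inj₂ refl) (inj₂ refl) ()

root-rescale : ∀ {n} {a b c d : Fin (suc n)} e → (∀ x → δ a x ℤ.- δ b x ≡ e ℤ.* (δ c x ℤ.- δ d x)) →
  root 1ℚ a b ≈V root (ι e) c d
root-rescale {a = a} {b} {c} {d} e h = (λ x → begin
  1ℚ ℚ.* (ι (δ a x) ℚ.- ι (δ b x))         ≡⟨ trans (ℚP.*-identityˡ _) (sym (ι-sub (δ a x) (δ b x))) ⟩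
  ι (δ a x ℤ.- δ b x)                       ≡⟨ trans (cong ι (h x)) (ι-* e (δ c x ℤ.- δ d x)) ⟩
  ι e ℚ.* ι (δ c x ℤ.- δ d x)               ≡⟨ cong (ι e ℚ.*_) (ι-sub (δ c x) (δ d x)) ⟩
  ι e ℚ.* (ι (δ c x) ℚ.- ι (δ d x))         ∎) , refl
  where open ≡-Reasoning

record Star {m N} (A B : Fin m → Fin N) : Set where
  field
    sign           : ℤ
    sign-±1        : IsSign sign
    centre         : Fin N
    leaf           : Fin m → Fin N
    centre≢leaf    : ∀ r → ¬ centre ≡ leaf r
    leaf-injective : ∀ r s → leaf r ≡ leaf s → r ≡ s
    root≡          : ∀ r x → δ (A r) x ℤ.- δ (B r) x ≡ sign ℤ.* (δ centre x ℤ.- δ (leaf r) x)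

Star-swap : ∀ {m N} {A B : Fin m → Fin N} → Star B A → Star A B
Star-swap {A = A} {B} st = record
  { sign = ℤ.- sign ; sign-±1 = neg-±1 sign-±1 ; centre = centre ; leaf = leaf
  ; centre≢leaf = centre≢leaf ; leaf-injective = leaf-injective
  ; root≡ = λ r x → trans (ℤS.solve 2 (λ p q → p ℤS.:- q ℤS.:= ℤS.:- (q ℤS.:- p)) refl (δ (A r) x) (δ (B r) x))
                   (trans (cong ℤ.-_ (root≡ r x)) (ℤP.neg-distribˡ-* sign _))
  }
  where
  open Star st
  neg-±1 : ∀ {v} → IsSign v → IsSign (ℤ.- v)
  neg-±1 (inj₁ refl) = inj₂ refl
  neg-±1 (inj₂ refl) = inj₁ refl

star-with-common-head : ∀ {m N} (A B : Fin m → Fin N) → (∀ r → ¬ A r ≡ B r) →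
  (∀ r s → ¬ r ≡ s → rootProduct (A r) (B r) (A s) (B s) ≡ + 1) →
  ∀ c → (∀ r → A r ≡ c) → Star A B
star-with-common-head A B A≢B product≡1 c A≡c = record
  { sign = + 1 ; sign-±1 = inj₁ refl ; centre = c ; leaf = B
  ; centre≢leaf = λ r c≡Br → A≢B r (trans (A≡c r) c≡Br)
  ; leaf-injective = B-injective
  ; root≡ = λ r x → trans (cong (λ a → δ a x ℤ.- δ (B r) x) (A≡c r)) (sym (ℤP.*-identityˡ _))
  }
  where
  B-injective : ∀ r s → B r ≡ B s → r ≡ s
  B-injective r s Br≡Bs with r Fin.≟ s
  ... | yes r≡s = r≡s
  ... | no r≢s with rootProduct≡1 (A r) (B r) (A s) (B s) (A≢B r) (product≡1 r s r≢s)
  ...   | inj₁ (_ , Br≢Bs) = ⊥-elim (Br≢Bs Br≡Bs)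
  ...   | inj₂ (_ , Ar≢As) = ⊥-elim (Ar≢As (trans (A≡c r) (sym (A≡c s))))

star : ∀ {m N} (A B : Fin (suc m) → Fin N) → (∀ r → ¬ A r ≡ B r) →
  (∀ r s → ¬ r ≡ s → rootProduct (A r) (B r) (A s) (B s) ≡ + 1) → Star A B
star A B A≢B product≡1 with FinP.all? (λ r → A r Fin.≟ A Fin.zero)
... | yes A≡A₀ = star-with-common-head A B A≢B product≡1 (A Fin.zero) A≡A₀
... | no ¬A≡A₀ with r₁ , Ar₁≢A₀ ← FinP.¬∀⟶∃¬ _ _ (λ r → A r Fin.≟ A Fin.zero) ¬A≡A₀ =
  Star-swap (star-with-common-head B A (λ r e → A≢B r (sym e))
    (λ r s r≢s → trans (rootProduct-swap (A r) (B r) (A s) (B s)) (product≡1 r s r≢s)) (B Fin.zero) B≡B₀)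
  where
  shared-end-with-0 : ∀ r → ¬ r ≡ Fin.zero → (A r ≡ A Fin.zero × ¬ B r ≡ B Fin.zero) ⊎ (B r ≡ B Fin.zero × ¬ A r ≡ A Fin.zero)
  shared-end-with-0 r r≢0 = rootProduct≡1 (A r) (B r) (A Fin.zero) (B Fin.zero) (A≢B r) (product≡1 r Fin.zero r≢0)
  Br₁≡B₀ : B r₁ ≡ B Fin.zero
  Br₁≡B₀ with shared-end-with-0 r₁ (λ r₁≡0 → Ar₁≢A₀ (cong A r₁≡0))
  ... | inj₁ (Ar₁≡A₀ , _) = ⊥-elim (Ar₁≢A₀ Ar₁≡A₀)
  ... | inj₂ (Br₁≡B₀ , _) = Br₁≡B₀
  -- A root sharing its head with root 0 would have to share its tail with root r₁.
  B≡B₀ : ∀ s → B s ≡ B Fin.zero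
  B≡B₀ s with s Fin.≟ Fin.zero
  ... | yes refl = refl
  ... | no s≢0 with shared-end-with-0 s s≢0
  ...   | inj₂ (Bs≡B₀ , _) = Bs≡B₀
  ...   | inj₁ (As≡A₀ , Bs≢B₀) with s Fin.≟ r₁
  ...     | yes refl = ⊥-elim (Ar₁≢A₀ As≡A₀)
  ...     | no s≢r₁ with rootProduct≡1 (A s) (B s) (A r₁) (B r₁) (A≢B s) (product≡1 s r₁ s≢r₁)
  ...       | inj₁ (As≡Ar₁ , _) = ⊥-elim (Ar₁≢A₀ (trans (sym As≡Ar₁) As≡A₀))
  ...       | inj₂ (Bs≡Br₁ , _) = ⊥-elim (Bs≢B₀ (trans Bs≡Br₁ Br₁≡B₀))

ScaleCongruence : (n i j k ℓ : ℕ) → Set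
ScaleCongruence n i j k ℓ =
  Σ ℕ λ t → 1 ≤ t × ((+ suc n ∣ + j ℤ.* + t ℤ.- + i) ⊎ (+ suc n ∣ + j ℤ.* + t ℤ.+ + i)) × k ≡ ℓ * (t * t)

k≡ℓT² : ∀ k ℓ n (S T : ℤ) → 1 ≤ k → + ℓ ℤ.* (S ℤ.* S) ≡ + k ℤ.* (+ suc n ℤ.* + suc n) →
  + ℓ ℤ.* (S ℤ.* T) ≡ + k ℤ.* + suc n → + k ≡ + ℓ ℤ.* (T ℤ.* T)
k≡ℓT² (suc k′) ℓ n S T _ ℓS²≡kN² ℓST≡kN =
  ℤP.*-cancelʳ-≡ (+ suc k′) (+ ℓ ℤ.* (T ℤ.* T)) (N′ ℤ.* N′) {{ℤ.≢-nonZero {N′ ℤ.* N′} (λ ())}} (begin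
    + suc k′ ℤ.* (N′ ℤ.* N′)              ≡⟨ sym ℓS²≡kN² ⟩
    + ℓ ℤ.* (S ℤ.* S)                     ≡⟨ cong (λ z → + ℓ ℤ.* (z ℤ.* z)) (sym S≡NT) ⟩
    + ℓ ℤ.* ((N′ ℤ.* T) ℤ.* (N′ ℤ.* T))   ≡⟨ ℤS.solve 3 (λ L Nn T → L ℤS.:* ((Nn ℤS.:* T) ℤS.:* (Nn ℤS.:* T)) ℤS.:= (L ℤS.:* (T ℤS.:* T)) ℤS.:* (Nn ℤS.:* Nn)) refl (+ ℓ) N′ T ⟩
    (+ ℓ ℤ.* (T ℤ.* T)) ℤ.* (N′ ℤ.* N′)   ∎)
  where
  open ≡-Reasoning
  N′ = + suc n
  ℓS*S≡ℓS*NT : (+ ℓ ℤ.* S) ℤ.* S ≡ (+ ℓ ℤ.* S) ℤ.* (N′ ℤ.* T)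
  ℓS*S≡ℓS*NT = begin
    (+ ℓ ℤ.* S) ℤ.* S                     ≡⟨ ℤS.solve 2 (λ L S → (L ℤS.:* S) ℤS.:* S ℤS.:= L ℤS.:* (S ℤS.:* S)) refl (+ ℓ) S ⟩
    + ℓ ℤ.* (S ℤ.* S)                     ≡⟨ ℓS²≡kN² ⟩
    + suc k′ ℤ.* (N′ ℤ.* N′)              ≡⟨ ℤS.solve 2 (λ K Nn → K ℤS.:* (Nn ℤS.:* Nn) ℤS.:= Nn ℤS.:* (K ℤS.:* Nn)) refl (+ suc k′) N′ ⟩
    N′ ℤ.* (+ suc k′ ℤ.* N′)              ≡⟨ cong (N′ ℤ.*_) (sym ℓST≡kN) ⟩
    N′ ℤ.* (+ ℓ ℤ.* (S ℤ.* T))            ≡⟨ ℤS.solve 4 (λ L S Nn T → Nn ℤS.:* (L ℤS.:* (S ℤS.:* T)) ℤS.:= (L ℤS.:* S) ℤS.:* (Nn ℤS.:* T)) refl (+ ℓ) S N′ T ⟩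
    (+ ℓ ℤ.* S) ℤ.* (N′ ℤ.* T)            ∎
  ℓS≢0 : ¬ (+ ℓ ℤ.* S ≡ + 0)
  ℓS≢0 ℓS≡0 with () ← trans (sym ℓS²≡kN²) (trans (ℤS.solve 2 (λ L S → L ℤS.:* (S ℤS.:* S) ℤS.:= (L ℤS.:* S) ℤS.:* S) refl (+ ℓ) S) (cong (ℤ._* S) ℓS≡0))
  S≡NT : N′ ℤ.* T ≡ S
  S≡NT = sym (ℤP.*-cancelˡ-≡ (+ ℓ ℤ.* S) S (N′ ℤ.* T) {{ℤ.≢-nonZero ℓS≢0}} ℓS*S≡ℓS*NT)

1≤t : ∀ k ℓ t → 1 ≤ k → k ≡ ℓ * (t * t) → 1 ≤ t
1≤t k ℓ zero    1≤k k≡0 with () ← ℕP.<⇒≢ 1≤k (sym (trans k≡0 (ℕP.*-zeroʳ ℓ)))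
1≤t k ℓ (suc t) _   _   = ℕ.s≤s ℕ.z≤n

quotient⇒∣ : ∀ N z q → z ≡ q ℤ.* + N → + N ∣ z
quotient⇒∣ N z q z≡qN = ℤ∣.∣⇒∣ᵤ (ℤ∣.divides q z≡qN)

congruence-for-∣T∣ : ∀ N i j (T e q : ℤ) → IsSign e → + j ℤ.* T ℤ.- e ℤ.* + i ≡ q ℤ.* + N →
  (+ N ∣ + j ℤ.* + ∣ T ∣ ℤ.- + i) ⊎ (+ N ∣ + j ℤ.* + ∣ T ∣ ℤ.+ + i)
congruence-for-∣T∣ N i j (+ t) e q (inj₁ refl) h = inj₁ (quotient⇒∣ N _ q (trans
  (ℤS.solve 2 (λ J I → J ℤS.:- I ℤS.:= J ℤS.:- ℤS.con (+ 1) ℤS.:* I) refl (+ j ℤ.* + t) (+ i)) h))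
congruence-for-∣T∣ N i j (+ t) e q (inj₂ refl) h = inj₂ (quotient⇒∣ N _ q (trans
  (ℤS.solve 2 (λ J I → J ℤS.:+ I ℤS.:= J ℤS.:- ℤS.con -[1+ 0 ] ℤS.:* I) refl (+ j ℤ.* + t) (+ i)) h))
congruence-for-∣T∣ N i j -[1+ t ] e q (inj₁ refl) h = inj₂ (quotient⇒∣ N _ (ℤ.- q) (trans
  (ℤS.solve 3 (λ J P I → J ℤS.:* P ℤS.:+ I ℤS.:= ℤS.:- (J ℤS.:* (ℤS.:- P) ℤS.:- ℤS.con (+ 1) ℤS.:* I)) refl (+ j) (+ suc t) (+ i))
  (trans (cong ℤ.-_ h) (ℤP.neg-distribˡ-* q (+ N)))))
congruence-for-∣T∣ N i j -[1+ t ] e q (inj₂ refl) h = inj₁ (quotient⇒∣ N _ (ℤ.- q) (trans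
  (ℤS.solve 3 (λ J P I → J ℤS.:* P ℤS.:- I ℤS.:= ℤS.:- (J ℤS.:* (ℤS.:- P) ℤS.:- ℤS.con -[1+ 0 ] ℤS.:* I)) refl (+ j) (+ suc t) (+ i))
  (trans (cong ℤ.-_ h) (ℤP.neg-distribˡ-* q (+ N)))))

congruence⇒signed-quotient : ∀ N i j t → (+ N ∣ + j ℤ.* + t ℤ.- + i) ⊎ (+ N ∣ + j ℤ.* + t ℤ.+ + i) →
  Σ ℤ λ e → Σ ℤ λ c → IsSign e × e ℤ.* + i ℤ.- + t ℤ.* + j ≡ c ℤ.* + N
congruence⇒signed-quotient N i j t (inj₁ N∣jt-i) with ℤ∣.divides q jt-i≡qN ← ℤ∣.∣ᵤ⇒∣ N∣jt-i =
  + 1 , ℤ.- q , inj₁ refl , trans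
    (ℤS.solve 3 (λ I T J → ℤS.con (+ 1) ℤS.:* I ℤS.:- T ℤS.:* J ℤS.:= ℤS.:- (J ℤS.:* T ℤS.:- I)) refl (+ i) (+ t) (+ j))
    (trans (cong ℤ.-_ jt-i≡qN) (ℤP.neg-distribˡ-* q (+ N)))
congruence⇒signed-quotient N i j t (inj₂ N∣jt+i) with ℤ∣.divides q jt+i≡qN ← ℤ∣.∣ᵤ⇒∣ N∣jt+i =
  -[1+ 0 ] , ℤ.- q , inj₂ refl , trans
    (ℤS.solve 3 (λ I T J → ℤS.con -[1+ 0 ] ℤS.:* I ℤS.:- T ℤS.:* J ℤS.:= ℤS.:- (J ℤS.:* T ℤS.:+ I)) refl (+ i) (+ t) (+ j))
    (trans (cong ℤ.-_ jt+i≡qN) (ℤP.neg-distribˡ-* q (+ N)))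

-- Sufficiency: x ↦ (e x_A, t x_z)

signed-scaling-represents : ∀ n i j k ℓ t (e c : ℤ) → i ≤ suc n → j ≤ suc n → IsSign e →
  e ℤ.* + i ℤ.- + t ℤ.* + j ≡ c ℤ.* + suc n → k ≡ ℓ * (t * t) →
  Represented n (k * suc n) i (ℓ * suc n) j
signed-scaling-represents n i j k ℓ t e c i≤1+n j≤1+n ±e ei-tj≡cN k≡ℓt² = σ , σ-∈ , (λ x y _ _ → σ-+ x y) , (λ x _ → σ-Q x)
  where
  open ≡-Reasoning
  σ : V n → V n
  σ (v , s) = (λ r → ι e ℚ.* v r) , ι (+ t) ℚ.* s

  -- the integer vector e[i] − t[j] of A_n
  D : Fin (suc n) → ℤ
  D r = c ℤ.- e ℤ.* inTail n i r ℤ.+ + t ℤ.* inTail n j r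

  ι[c] : ι c ≡ (ι e ℚ.* ι (+ i) ℚ.- ι (+ t) ℚ.* ι (+ j)) ℚ.* ω n
  ι[c] = begin
    ι c                                                ≡⟨ sym (ι[1+n]*[*ω] n (ι c)) ⟩
    ι (+ suc n) ℚ.* (ι c ℚ.* ω n)                      ≡⟨ solve 3 (λ N C w → N :* (C :* w) := (C :* N) :* w) refl (ι (+ suc n)) (ι c) (ω n) ⟩
    (ι c ℚ.* ι (+ suc n)) ℚ.* ω n                      ≡⟨ cong (ℚ._* ω n) (sym (trans (cong ι ei-tj≡cN) (ι-* c (+ suc n)))) ⟩
    ι (e ℤ.* + i ℤ.- + t ℤ.* + j) ℚ.* ω n              ≡⟨ cong (ℚ._* ω n) (trans (ι-sub (e ℤ.* + i) (+ t ℤ.* + j)) (cong₂ ℚ._-_ (ι-* e (+ i)) (ι-* (+ t) (+ j)))) ⟩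
    (ι e ℚ.* ι (+ i) ℚ.- ι (+ t) ℚ.* ι (+ j)) ℚ.* ω n  ∎

  ι[D] : ∀ r → ι (D r) ≡ ι e ℚ.* glue n i r ℚ.- ι (+ t) ℚ.* glue n j r
  ι[D] r = begin
    ι (D r)                                                  ≡⟨ trans (ι-+ (c ℤ.- e ℤ.* bᵢ) (+ t ℤ.* bⱼ)) (cong₂ ℚ._+_ (trans (ι-sub c (e ℤ.* bᵢ)) (cong₂ ℚ._-_ ι[c] (ι-* e bᵢ))) (ι-* (+ t) bⱼ)) ⟩
    (ι e ℚ.* ι (+ i) ℚ.- ι (+ t) ℚ.* ι (+ j)) ℚ.* ω n ℚ.- ι e ℚ.* ι bᵢ ℚ.+ ι (+ t) ℚ.* ι bⱼ
        ≡⟨ solve 7 (λ E I T J w bi bj → (E :* I :- T :* J) :* w :- E :* bi :+ T :* bj := E :* (I :* w :- bi) :- T :* (J :* w :- bj))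
             refl (ι e) (ι (+ i)) (ι (+ t)) (ι (+ j)) (ω n) (ι bᵢ) (ι bⱼ) ⟩
    ι e ℚ.* (ι (+ i) ℚ.* ω n ℚ.- ι bᵢ) ℚ.- ι (+ t) ℚ.* (ι (+ j) ℚ.* ω n ℚ.- ι bⱼ)
        ≡⟨ sym (cong₂ (λ a b → ι e ℚ.* a ℚ.- ι (+ t) ℚ.* b) (glue≡ n i i≤1+n r) (glue≡ n j j≤1+n r)) ⟩
    ι e ℚ.* glue n i r ℚ.- ι (+ t) ℚ.* glue n j r            ∎
    where
    bᵢ = inTail n i r
    bⱼ = inTail n j r

  sumℚ-ι[D] : sumℚ (λ r → ι (D r)) ≡ 0ℚ
  sumℚ-ι[D] = begin
    sumℚ (λ r → ι (D r))                                             ≡⟨ trans (sumℚ-cong ι[D]) (sumℚ-- (λ r → ι e ℚ.* glue n i r) (λ r → ι (+ t) ℚ.* glue n j r)) ⟩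
    sumℚ (λ r → ι e ℚ.* glue n i r) ℚ.- sumℚ (λ r → ι (+ t) ℚ.* glue n j r)
                                                                     ≡⟨ cong₂ ℚ._-_ (trans (sumℚ-*ˡ (ι e) (glue n i)) (cong (ι e ℚ.*_) (sumℚ-glue n i i≤1+n)))
                                                                                    (trans (sumℚ-*ˡ (ι (+ t)) (glue n j)) (cong (ι (+ t) ℚ.*_) (sumℚ-glue n j j≤1+n))) ⟩
    ι e ℚ.* 0ℚ ℚ.- ι (+ t) ℚ.* 0ℚ                                    ≡⟨ solve 2 (λ a b → a :* con 0ℚ :- b :* con 0ℚ := con 0ℚ) refl (ι e) (ι (+ t)) ⟩
    0ℚ                                                               ∎

  σ-∈ : ∀ x → InGlued n (k * suc n) i x → InGlued n (ℓ * suc n) j (σ x)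
  σ-∈ (v , s) (a , p , m , Σa≡0 , v≡ , s≡) =
    (λ r → e ℤ.* a r ℤ.+ m ℤ.* D r) , + t ℤ.* p , + t ℤ.* m ,
    sumℤ≡0 (λ r → e ℤ.* a r ℤ.+ m ℤ.* D r) (begin
      sumℚ (λ r → ι (e ℤ.* a r ℤ.+ m ℤ.* D r))                ≡⟨ sumℚ-cong (λ r → trans (ι-+ (e ℤ.* a r) (m ℤ.* D r)) (cong₂ ℚ._+_ (ι-* e (a r)) (ι-* m (D r)))) ⟩
      sumℚ (λ r → ι e ℚ.* ι (a r) ℚ.+ ι m ℚ.* ι (D r))        ≡⟨ trans (sumℚ-+ (λ r → ι e ℚ.* ι (a r)) (λ r → ι m ℚ.* ι (D r)))
                                                                      (cong₂ ℚ._+_ (sumℚ-*ˡ (ι e) (λ r → ι (a r))) (sumℚ-*ˡ (ι m) (λ r → ι (D r)))) ⟩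
      ι e ℚ.* sumℚ (λ r → ι (a r)) ℚ.+ ι m ℚ.* sumℚ (λ r → ι (D r))
                                                               ≡⟨ cong₂ (λ p q → ι e ℚ.* p ℚ.+ ι m ℚ.* q) (trans (sym (ι-sumℤ a)) (cong ι Σa≡0)) sumℚ-ι[D] ⟩
      ι e ℚ.* 0ℚ ℚ.+ ι m ℚ.* 0ℚ                                ≡⟨ solve 2 (λ a b → a :* con 0ℚ :+ b :* con 0ℚ := con 0ℚ) refl (ι e) (ι m) ⟩
      0ℚ                                                       ∎) ,
    (λ r → begin
      ι e ℚ.* v r                                                       ≡⟨ cong (ι e ℚ.*_) (v≡ r) ⟩
      ι e ℚ.* (ι (a r) ℚ.+ ι m ℚ.* glue n i r)                          ≡⟨ solve 6 (λ E A M T gi gj → E :* (A :+ M :* gi) := E :* A :+ M :* (E :* gi :- T :* gj) :+ T :* M :* gj)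
                                                                             refl (ι e) (ι (a r)) (ι m) (ι (+ t)) (glue n i r) (glue n j r) ⟩
      ι e ℚ.* ι (a r) ℚ.+ ι m ℚ.* (ι e ℚ.* glue n i r ℚ.- ι (+ t) ℚ.* glue n j r) ℚ.+ ι (+ t) ℚ.* ι m ℚ.* glue n j r
                                                                        ≡⟨ sym (cong₂ ℚ._+_ (trans (ι-+ (e ℤ.* a r) (m ℤ.* D r)) (cong₂ ℚ._+_ (ι-* e (a r)) (trans (ι-* m (D r)) (cong (ι m ℚ.*_) (ι[D] r)))))
                                                                                             (cong (ℚ._* glue n j r) (ι-* (+ t) m))) ⟩
      ι (e ℤ.* a r ℤ.+ m ℤ.* D r) ℚ.+ ι (+ t ℤ.* m) ℚ.* glue n j r      ∎) ,
    (begin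
      ι (+ t) ℚ.* s                                       ≡⟨ cong (ι (+ t) ℚ.*_) s≡ ⟩
      ι (+ t) ℚ.* (ι p ℚ.+ ι m ℚ.* ω n)                   ≡⟨ solve 4 (λ T P M w → T :* (P :+ M :* w) := T :* P :+ T :* M :* w) refl (ι (+ t)) (ι p) (ι m) (ω n) ⟩
      ι (+ t) ℚ.* ι p ℚ.+ ι (+ t) ℚ.* ι m ℚ.* ω n         ≡⟨ sym (cong₂ (λ a b → a ℚ.+ b ℚ.* ω n) (ι-* (+ t) p) (ι-* (+ t) m)) ⟩
      ι (+ t ℤ.* p) ℚ.+ ι (+ t ℤ.* m) ℚ.* ω n             ∎)

  σ-+ : ∀ x y → σ (x +V y) ≈V (σ x +V σ y)
  σ-+ (u , s) (v , s′) = (λ r → ℚP.*-distribˡ-+ (ι e) (u r) (v r)) , ℚP.*-distribˡ-+ (ι (+ t)) s s′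

  σ-Q : ∀ x → Q (ℓ * suc n) (σ x) ≡ Q (k * suc n) x
  σ-Q (v , s) = cong₂ ℚ._+_
    (sumℚ-cong (λ r → trans (solve 3 (λ E a b → E :* a :* (E :* b) := (E :* E) :* (a :* b)) refl (ι e) (v r) (v r))
                            (trans (cong (ℚ._* (v r ℚ.* v r)) (IsSign⇒ι²≡1 ±e)) (ℚP.*-identityˡ (v r ℚ.* v r)))))
    (trans (solve 3 (λ C T s → C :* (T :* s :* (T :* s)) := (C :* (T :* T)) :* (s :* s)) refl (ι (+ (ℓ * suc n))) (ι (+ t)) s)
           (cong (ℚ._* (s ℚ.* s)) (sym ι[kN])))
    where
    ι[kN] : ι (+ (k * suc n)) ≡ ι (+ (ℓ * suc n)) ℚ.* (ι (+ t) ℚ.* ι (+ t))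
    ι[kN] = begin
      ι (+ (k * suc n))                                   ≡⟨ cong (λ z → ι (+ (z * suc n))) k≡ℓt² ⟩
      ι (+ (ℓ * (t * t) * suc n))                         ≡⟨ trans (ι-pos-* (ℓ * (t * t)) (suc n)) (cong (ℚ._* ι (+ suc n)) (trans (ι-pos-* ℓ (t * t)) (cong (ι (+ ℓ) ℚ.*_) (ι-pos-* t t)))) ⟩
      ι (+ ℓ) ℚ.* (ι (+ t) ℚ.* ι (+ t)) ℚ.* ι (+ suc n)    ≡⟨ solve 3 (λ L T N → L :* (T :* T) :* N := (L :* N) :* (T :* T)) refl (ι (+ ℓ)) (ι (+ t)) (ι (+ suc n)) ⟩
      (ι (+ ℓ) ℚ.* ι (+ suc n)) ℚ.* (ι (+ t) ℚ.* ι (+ t))  ≡⟨ cong (ℚ._* (ι (+ t) ℚ.* ι (+ t))) (sym (ι-pos-* ℓ (suc n))) ⟩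
      ι (+ (ℓ * suc n)) ℚ.* (ι (+ t) ℚ.* ι (+ t))         ∎

-- Necessity

module Necessity (n′ i j k ℓ : ℕ) (i≤n : i ≤ suc n′) (j≤n : j ≤ suc n′) (1≤k : 1 ≤ k)
  (rootsY⊆An : ∀ x → RootSub (suc n′) (ℓ * suc (suc n′)) j x → InAn x)
  (σ : V (suc n′) → V (suc n′))
  (σ-∈ : ∀ x → InGlued (suc n′) (k * suc (suc n′)) i x → InGlued (suc n′) (ℓ * suc (suc n′)) j (σ x))
  (σ-+ : ∀ x y → InGlued (suc n′) (k * suc (suc n′)) i x → InGlued (suc n′) (k * suc (suc n′)) i y →
         σ (x +V y) ≈V (σ x +V σ y))
  (σ-Q : ∀ x → InGlued (suc n′) (k * suc (suc n′)) i x → Q (ℓ * suc (suc n′)) (σ x) ≡ Q (k * suc (suc n′)) x)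
  where

  open ≡-Reasoning

  n N cX cY : ℕ
  n = suc n′
  N = suc n
  cX = k * N
  cY = ℓ * N

  N′ : ℚ
  N′ = ι (+ N)

  X : V n → Set
  X = InGlued n cX i

  σ-B : ∀ x y → X x → X y → B cY (σ x) (σ y) ≡ B cX x y
  σ-B = B-preserved cX cY X σ (InGlued-+ n cX i) σ-+ σ-Q

  d : Fin n → V n
  d r = root 1ℚ Fin.zero (Fin.suc r)

  d-∈ : ∀ r → X (d r)
  d-∈ r = root-InGlued n cX i Fin.zero (Fin.suc r)

  B-d-d : ∀ r s → B cX (d r) (d s) ≡ ι ((+ 1 ℤ.- + 0) ℤ.- (+ 0 ℤ.- δ r s))
  B-d-d r s = B-root-root cX Fin.zero (Fin.suc r) Fin.zero (Fin.suc s)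

  Q-σd≡2 : ∀ r → Q cY (σ (d r)) ≡ ι (+ 2)
  Q-σd≡2 r = trans (σ-Q (d r) (d-∈ r)) (trans (B-d-d r r) (cong (λ δrr → ι ((+ 1 ℤ.- + 0) ℤ.- (+ 0 ℤ.- δrr))) (δ-refl r)))

  σd-root : ∀ r → Σ (Fin N) λ a → Σ (Fin N) λ b → ¬ a ≡ b × σ (d r) ≈V root 1ℚ a b
  σd-root r = InAn-norm2⇒root cY (rootsY⊆An (σ (d r)) (sp-gen (σ-∈ (d r) (d-∈ r) , ℚP.≤-reflexive (Q-σd≡2 r)))) (Q-σd≡2 r)

  hd tl : Fin n → Fin N
  hd r = proj₁ (σd-root r)
  tl r = proj₁ (proj₂ (σd-root r))

  σd≈root : ∀ r → σ (d r) ≈V root 1ℚ (hd r) (tl r)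
  σd≈root r = proj₂ (proj₂ (proj₂ (σd-root r)))

  products≡1 : ∀ r s → ¬ r ≡ s → rootProduct (hd r) (tl r) (hd s) (tl s) ≡ + 1
  products≡1 r s r≢s = ι-injective {rootProduct (hd r) (tl r) (hd s) (tl s)} {+ 1} (begin
    ι (rootProduct (hd r) (tl r) (hd s) (tl s))            ≡⟨ sym (B-root-root cY (hd r) (tl r) (hd s) (tl s)) ⟩
    B cY (root 1ℚ (hd r) (tl r)) (root 1ℚ (hd s) (tl s))   ≡⟨ sym (B-cong cY (σd≈root r) (σd≈root s)) ⟩
    B cY (σ (d r)) (σ (d s))                               ≡⟨ σ-B (d r) (d s) (d-∈ r) (d-∈ s) ⟩
    B cX (d r) (d s)                                       ≡⟨ trans (B-d-d r s) (cong (λ δrs → ι ((+ 1 ℤ.- + 0) ℤ.- (+ 0 ℤ.- δrs))) (δ-≢ r≢s)) ⟩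
    ι (+ 1)                                                ∎)

  open Star (star hd tl (λ r → proj₁ (proj₂ (proj₂ (σd-root r)))) products≡1)

  ε : ℚ
  ε = ι sign

  σd≈star : ∀ r → σ (d r) ≈V root ε centre (leaf r)
  σd≈star r = ≈V-trans {x = σ (d r)} {root 1ℚ (hd r) (tl r)} {root ε centre (leaf r)}
    (σd≈root r) (root-rescale {a = hd r} {tl r} {centre} {leaf r} sign (root≡ r))

  π : Fin N → Fin N
  π Fin.zero    = centre
  π (Fin.suc r) = leaf r

  π-injective : ∀ a b → π a ≡ π b → a ≡ b
  π-injective Fin.zero    Fin.zero    _ = refl
  π-injective Fin.zero    (Fin.suc b) e = ⊥-elim (centre≢leaf b e)
  π-injective (Fin.suc a) Fin.zero    e = ⊥-elim (centre≢leaf a (sym e))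
  π-injective (Fin.suc a) (Fin.suc b) e = cong Fin.suc (leaf-injective a b e)

  σ-differences : ∀ x → X x → ∀ r →
    ε ℚ.* (proj₁ (σ x) centre ℚ.- proj₁ (σ x) (leaf r)) ≡ proj₁ x Fin.zero ℚ.- proj₁ x (Fin.suc r)
  σ-differences x x-∈ r = begin
    ε ℚ.* (proj₁ (σ x) centre ℚ.- proj₁ (σ x) (leaf r))     ≡⟨ sym (B-root cY (proj₁ (σ x)) (proj₂ (σ x)) ε centre (leaf r)) ⟩
    B cY (σ x) (root ε centre (leaf r))                     ≡⟨ sym (B-cong cY {σ x} {σ x} ((λ _ → refl) , refl) (σd≈star r)) ⟩
    B cY (σ x) (σ (d r))                                    ≡⟨ σ-B x (d r) x-∈ (d-∈ r) ⟩
    B cX x (d r)                                            ≡⟨ B-root cX (proj₁ x) (proj₂ x) 1ℚ Fin.zero (Fin.suc r) ⟩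
    1ℚ ℚ.* (proj₁ x Fin.zero ℚ.- proj₁ x (Fin.suc r))       ≡⟨ ℚP.*-identityˡ _ ⟩
    proj₁ x Fin.zero ℚ.- proj₁ x (Fin.suc r)                ∎

  σ-coord : ∀ x → X x → ∀ z → proj₁ (σ x) (π z) ≡ proj₁ (σ x) centre ℚ.- ε ℚ.* (proj₁ x Fin.zero ℚ.- proj₁ x z)
  σ-coord x x-∈ Fin.zero = solve 3 (λ y E f → y := y :- E :* (f :- f)) refl (proj₁ (σ x) centre) ε (proj₁ x Fin.zero)
  σ-coord x x-∈ (Fin.suc r) = begin
    yl                                  ≡⟨ solve 2 (λ a b → b := a :- con 1ℚ :* (a :- b)) refl yc yl ⟩
    yc ℚ.- 1ℚ ℚ.* (yc ℚ.- yl)            ≡⟨ cong (λ w → yc ℚ.- w ℚ.* (yc ℚ.- yl)) (sym (IsSign⇒ι²≡1 sign-±1)) ⟩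
    yc ℚ.- (ε ℚ.* ε) ℚ.* (yc ℚ.- yl)     ≡⟨ solve 3 (λ a b E → a :- (E :* E) :* (a :- b) := a :- E :* (E :* (a :- b))) refl yc yl ε ⟩
    yc ℚ.- ε ℚ.* (ε ℚ.* (yc ℚ.- yl))     ≡⟨ cong (λ w → yc ℚ.- ε ℚ.* w) (σ-differences x x-∈ r) ⟩
    yc ℚ.- ε ℚ.* (proj₁ x Fin.zero ℚ.- proj₁ x (Fin.suc r)) ∎
    where
    yc = proj₁ (σ x) centre
    yl = proj₁ (σ x) (leaf r)

  -- Sum σ-coord over the permutation π; both x and σ x have coordinate sum 0.
  σ-centre : ∀ x → X x → sumℚ (proj₁ x) ≡ 0ℚ → proj₁ (σ x) centre ≡ ε ℚ.* proj₁ x Fin.zero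
  σ-centre x x-∈ Σx≡0 = ι[1+n]*-cancelˡ n (begin
    N′ ℚ.* yc                                        ≡⟨ solve 4 (λ N y e x → N :* y := (N :* y :- e :* (N :* x :- con 0ℚ)) :+ N :* (e :* x)) refl N′ yc ε x₀ ⟩
    (N′ ℚ.* yc ℚ.- ε ℚ.* (N′ ℚ.* x₀ ℚ.- 0ℚ)) ℚ.+ N′ ℚ.* (ε ℚ.* x₀) ≡⟨ cong (ℚ._+ N′ ℚ.* (ε ℚ.* x₀)) vanishes ⟩
    0ℚ ℚ.+ N′ ℚ.* (ε ℚ.* x₀)                         ≡⟨ ℚP.+-identityˡ _ ⟩
    N′ ℚ.* (ε ℚ.* x₀)                                ∎)
    where
    y = proj₁ (σ x)
    yc = y centre
    x₀ = proj₁ x Fin.zero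
    vanishes : N′ ℚ.* yc ℚ.- ε ℚ.* (N′ ℚ.* x₀ ℚ.- 0ℚ) ≡ 0ℚ
    vanishes = begin
      N′ ℚ.* yc ℚ.- ε ℚ.* (N′ ℚ.* x₀ ℚ.- 0ℚ)            ≡⟨ cong (λ S → N′ ℚ.* yc ℚ.- ε ℚ.* (N′ ℚ.* x₀ ℚ.- S)) (sym Σx≡0) ⟩
      N′ ℚ.* yc ℚ.- ε ℚ.* (N′ ℚ.* x₀ ℚ.- sumℚ (proj₁ x)) ≡⟨ sym (sumℚ-affine N yc ε x₀ (proj₁ x)) ⟩
      sumℚ (λ z → yc ℚ.- ε ℚ.* (x₀ ℚ.- proj₁ x z))      ≡⟨ sym (sumℚ-cong (σ-coord x x-∈)) ⟩
      sumℚ (λ z → y (π z))                              ≡⟨ sym (sumℚ-reindex π π-injective y) ⟩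
      sumℚ y                                            ≡⟨ InGlued⇒sumℚ≡0 n cY j {y} {proj₂ (σ x)} (ℕP.m≤n⇒m≤1+n j≤n) (σ-∈ x x-∈) ⟩
      0ℚ                                                ∎

  ẑ ĝ : V n
  ẑ = (λ _ → 0ℚ) , 1ℚ
  ĝ = glue n i , ω n

  ẑ-∈ : X ẑ
  ẑ-∈ = z-InGlued n cX i

  ĝ-∈ : X ĝ
  ĝ-∈ = glue-InGlued n cX i

  σẑ-A≡0 : ∀ w → proj₁ (σ ẑ) w ≡ 0ℚ
  σẑ-A≡0 w = subst (λ q → proj₁ (σ ẑ) q ≡ 0ℚ) (proj₂ (injective⇒surjective π π-injective w))
    (at-π (proj₁ (injective⇒surjective π π-injective w)))
    where
    at-π : ∀ u → proj₁ (σ ẑ) (π u) ≡ 0ℚ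
    at-π u = begin
      proj₁ (σ ẑ) (π u)                           ≡⟨ σ-coord ẑ ẑ-∈ u ⟩
      proj₁ (σ ẑ) centre ℚ.- ε ℚ.* (0ℚ ℚ.- 0ℚ)    ≡⟨ cong (λ c → c ℚ.- ε ℚ.* (0ℚ ℚ.- 0ℚ)) (σ-centre ẑ ẑ-∈ (sumℚ-zero N)) ⟩
      ε ℚ.* 0ℚ ℚ.- ε ℚ.* (0ℚ ℚ.- 0ℚ)              ≡⟨ solve 1 (λ E → E :* con 0ℚ :- E :* (con 0ℚ :- con 0ℚ) := con 0ℚ) refl ε ⟩
      0ℚ                                          ∎

  σĝ-centre : proj₁ (σ ĝ) centre ≡ ε ℚ.* (ι (+ i) ℚ.* ω n)
  σĝ-centre = trans (σ-centre ĝ ĝ-∈ (sumℚ-glue n i (ℕP.m≤n⇒m≤1+n i≤n))) (cong (ε ℚ.*_) (glue-zero n i i≤n))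

  Q-σẑ : ι (+ cY) ℚ.* (proj₂ (σ ẑ) ℚ.* proj₂ (σ ẑ)) ≡ ι (+ cX) ℚ.* (1ℚ ℚ.* 1ℚ)
  Q-σẑ = begin
    ι (+ cY) ℚ.* (proj₂ (σ ẑ) ℚ.* proj₂ (σ ẑ))   ≡⟨ sym (B-A-free {n} cY (proj₁ (σ ẑ)) (proj₁ (σ ẑ)) (proj₂ (σ ẑ)) (proj₂ (σ ẑ)) σẑ-A≡0) ⟩
    Q cY (σ ẑ)                                   ≡⟨ σ-Q ẑ ẑ-∈ ⟩
    Q cX ẑ                                       ≡⟨ B-A-free {n} cX (λ _ → 0ℚ) (λ _ → 0ℚ) 1ℚ 1ℚ (λ _ → refl) ⟩
    ι (+ cX) ℚ.* (1ℚ ℚ.* 1ℚ)                     ∎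

  B-σẑ-σĝ : ι (+ cY) ℚ.* (proj₂ (σ ẑ) ℚ.* proj₂ (σ ĝ)) ≡ ι (+ cX) ℚ.* (1ℚ ℚ.* ω n)
  B-σẑ-σĝ = begin
    ι (+ cY) ℚ.* (proj₂ (σ ẑ) ℚ.* proj₂ (σ ĝ))   ≡⟨ sym (B-A-free {n} cY (proj₁ (σ ẑ)) (proj₁ (σ ĝ)) (proj₂ (σ ẑ)) (proj₂ (σ ĝ)) σẑ-A≡0) ⟩
    B cY (σ ẑ) (σ ĝ)                             ≡⟨ σ-B ẑ ĝ ẑ-∈ ĝ-∈ ⟩
    B cX ẑ ĝ                                     ≡⟨ B-A-free {n} cX (λ _ → 0ℚ) (glue n i) 1ℚ (ω n) (λ _ → refl) ⟩
    ι (+ cX) ℚ.* (1ℚ ℚ.* ω n)                    ∎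

  ι[ℓST] : ∀ (S T : ℤ) s t → ι S ≡ N′ ℚ.* s → ι T ≡ N′ ℚ.* t → ι (+ ℓ ℤ.* (S ℤ.* T)) ≡ N′ ℚ.* (ι (+ cY) ℚ.* (s ℚ.* t))
  ι[ℓST] S T s t ι[S] ι[T] = begin
    ι (+ ℓ ℤ.* (S ℤ.* T))                           ≡⟨ trans (ι-* (+ ℓ) (S ℤ.* T)) (cong (ι (+ ℓ) ℚ.*_) (trans (ι-* S T) (cong₂ ℚ._*_ ι[S] ι[T]))) ⟩
    ι (+ ℓ) ℚ.* ((N′ ℚ.* s) ℚ.* (N′ ℚ.* t))          ≡⟨ solve 4 (λ L Nn s t → L :* ((Nn :* s) :* (Nn :* t)) := Nn :* ((L :* Nn) :* (s :* t))) refl (ι (+ ℓ)) N′ s t ⟩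
    N′ ℚ.* ((ι (+ ℓ) ℚ.* N′) ℚ.* (s ℚ.* t))          ≡⟨ cong (λ c → N′ ℚ.* (c ℚ.* (s ℚ.* t))) (sym (ι-pos-* ℓ N)) ⟩
    N′ ℚ.* (ι (+ cY) ℚ.* (s ℚ.* t))                  ∎

  from-memberships : InGlued n cY j (σ ẑ) → InGlued n cY j (σ ĝ) → ScaleCongruence n i j k ℓ
  from-memberships (_ , pẑ , mẑ , _ , _ , sẑ≡) (aĝ , pĝ , mĝ , _ , yĝ≡ , sĝ≡) =
    ∣ T ∣ , 1≤t k ℓ ∣ T ∣ 1≤k k≡ℓ∣T∣² , congruence-for-∣T∣ N i j T sign q sign-±1 jT-εi≡qN , k≡ℓ∣T∣²
    where
    S T q : ℤ
    S = + N ℤ.* pẑ ℤ.+ mẑ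
    T = + N ℤ.* pĝ ℤ.+ mĝ
    b = inTail n j centre
    q = + j ℤ.* pĝ ℤ.- (aĝ centre ℤ.- mĝ ℤ.* b)

    εi : sign ℤ.* + i ≡ + N ℤ.* (aĝ centre ℤ.- mĝ ℤ.* b) ℤ.+ mĝ ℤ.* + j
    εi = ι-injective {sign ℤ.* + i} {+ N ℤ.* (aĝ centre ℤ.- mĝ ℤ.* b) ℤ.+ mĝ ℤ.* + j} (begin
      ι (sign ℤ.* + i)                              ≡⟨ ι-* sign (+ i) ⟩
      ε ℚ.* ι (+ i)                                 ≡⟨ sym (ι[1+n]*[*ω] n (ε ℚ.* ι (+ i))) ⟩
      N′ ℚ.* ((ε ℚ.* ι (+ i)) ℚ.* ω n)              ≡⟨ cong (N′ ℚ.*_) (trans (ℚP.*-assoc ε (ι (+ i)) (ω n)) (sym σĝ-centre)) ⟩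
      N′ ℚ.* proj₁ (σ ĝ) centre                     ≡⟨ ι[1+n]*glued-coord n j (aĝ centre) mĝ centre (ℕP.m≤n⇒m≤1+n j≤n) (yĝ≡ centre) ⟩
      ι (+ N ℤ.* (aĝ centre ℤ.- mĝ ℤ.* b) ℤ.+ mĝ ℤ.* + j) ∎)

    jT-εi≡qN : + j ℤ.* T ℤ.- sign ℤ.* + i ≡ q ℤ.* + N
    jT-εi≡qN = trans (cong (λ e → + j ℤ.* T ℤ.- e) εi)
      (ℤS.solve 6 (λ J Nn P M A Bb → J ℤS.:* (Nn ℤS.:* P ℤS.:+ M) ℤS.:- (Nn ℤS.:* (A ℤS.:- M ℤS.:* Bb) ℤS.:+ M ℤS.:* J)
                     ℤS.:= (J ℤS.:* P ℤS.:- (A ℤS.:- M ℤS.:* Bb)) ℤS.:* Nn) refl (+ j) (+ N) pĝ mĝ (aĝ centre) b)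

    ι[S] : ι S ≡ N′ ℚ.* proj₂ (σ ẑ)
    ι[S] = sym (ι[1+n]*glued-zcoord n pẑ mẑ sẑ≡)

    ι[T] : ι T ≡ N′ ℚ.* proj₂ (σ ĝ)
    ι[T] = sym (ι[1+n]*glued-zcoord n pĝ mĝ sĝ≡)

    ℓS²≡kN² : + ℓ ℤ.* (S ℤ.* S) ≡ + k ℤ.* (+ N ℤ.* + N)
    ℓS²≡kN² = ι-injective {+ ℓ ℤ.* (S ℤ.* S)} {+ k ℤ.* (+ N ℤ.* + N)} (begin
      ι (+ ℓ ℤ.* (S ℤ.* S))                      ≡⟨ ι[ℓST] S S _ _ ι[S] ι[S] ⟩
      N′ ℚ.* (ι (+ cY) ℚ.* (proj₂ (σ ẑ) ℚ.* proj₂ (σ ẑ))) ≡⟨ cong (N′ ℚ.*_) Q-σẑ ⟩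
      N′ ℚ.* (ι (+ cX) ℚ.* (1ℚ ℚ.* 1ℚ))           ≡⟨ cong (λ c → N′ ℚ.* (c ℚ.* (1ℚ ℚ.* 1ℚ))) (ι-pos-* k N) ⟩
      N′ ℚ.* ((ι (+ k) ℚ.* N′) ℚ.* (1ℚ ℚ.* 1ℚ))   ≡⟨ solve 2 (λ Nn K → Nn :* ((K :* Nn) :* (con 1ℚ :* con 1ℚ)) := K :* (Nn :* Nn)) refl N′ (ι (+ k)) ⟩
      ι (+ k) ℚ.* (N′ ℚ.* N′)                     ≡⟨ sym (trans (ι-* (+ k) (+ N ℤ.* + N)) (cong (ι (+ k) ℚ.*_) (ι-* (+ N) (+ N)))) ⟩
      ι (+ k ℤ.* (+ N ℤ.* + N))                   ∎)

    ℓST≡kN : + ℓ ℤ.* (S ℤ.* T) ≡ + k ℤ.* + N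
    ℓST≡kN = ι-injective {+ ℓ ℤ.* (S ℤ.* T)} {+ k ℤ.* + N} (begin
      ι (+ ℓ ℤ.* (S ℤ.* T))                      ≡⟨ ι[ℓST] S T _ _ ι[S] ι[T] ⟩
      N′ ℚ.* (ι (+ cY) ℚ.* (proj₂ (σ ẑ) ℚ.* proj₂ (σ ĝ))) ≡⟨ cong (N′ ℚ.*_) B-σẑ-σĝ ⟩
      N′ ℚ.* (ι (+ cX) ℚ.* (1ℚ ℚ.* ω n))          ≡⟨ cong (λ c → N′ ℚ.* (c ℚ.* (1ℚ ℚ.* ω n))) (ι-pos-* k N) ⟩
      N′ ℚ.* ((ι (+ k) ℚ.* N′) ℚ.* (1ℚ ℚ.* ω n))  ≡⟨ solve 3 (λ Nn K w → Nn :* ((K :* Nn) :* (con 1ℚ :* w)) := Nn :* ((K :* Nn) :* w)) refl N′ (ι (+ k)) (ω n) ⟩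
      N′ ℚ.* ((ι (+ k) ℚ.* N′) ℚ.* ω n)          ≡⟨ ι[1+n]*[*ω] n (ι (+ k) ℚ.* N′) ⟩
      ι (+ k) ℚ.* N′                             ≡⟨ sym (ι-* (+ k) (+ N)) ⟩
      ι (+ k ℤ.* + N)                            ∎)

    k≡ℓ∣T∣² : k ≡ ℓ * (∣ T ∣ * ∣ T ∣)
    k≡ℓ∣T∣² = ℤP.+-injective (trans (k≡ℓT² k ℓ n S T 1≤k ℓS²≡kN² ℓST≡kN)
      (trans (cong (+ ℓ ℤ.*_) (i*i≡+∣i∣*∣i∣ T)) (sym (ℤP.pos-* ℓ (∣ T ∣ * ∣ T ∣)))))

  necessary : ScaleCongruence n i j k ℓ
  necessary = from-memberships (σ-∈ ẑ ẑ-∈) (σ-∈ ĝ ĝ-∈)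

lemma3p4 : (n i j k ℓ : ℕ) → 1 ≤ n → i ≤ ⌊ suc n /2⌋ → j ≤ ⌊ suc n /2⌋ → 1 ≤ k → 1 ≤ ℓ
    → Integral n (k * suc n) i → Integral n (ℓ * suc n) j
    → RootSubIsAn n (k * suc n) i → RootSubIsAn n (ℓ * suc n) j
    → Represented n (k * suc n) i (ℓ * suc n) j
      ⇔ Σ ℕ (λ t → 1 ≤ t
          × (((+ suc n) ∣ ((+ j) ℤ.* (+ t) ℤ.- (+ i))) ⊎ ((+ suc n) ∣ ((+ j) ℤ.* (+ t) ℤ.+ (+ i))))
          × (k ≡ ℓ * (t * t)))

lemma3p4 (suc n′) i j k ℓ (ℕ.s≤s _) i≤⌊n+1/2⌋ j≤⌊n+1/2⌋ 1≤k _ _ _ _ rootSubY = mk⇔ necessary sufficient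
  where
  ⌊n+1/2⌋≤n : ⌊ suc (suc n′) /2⌋ ≤ suc n′
  ⌊n+1/2⌋≤n = ℕP.≤-pred (ℕP.⌊n/2⌋<n (suc n′))
  i≤n : i ≤ suc n′
  i≤n = ℕP.≤-trans i≤⌊n+1/2⌋ ⌊n+1/2⌋≤n
  j≤n : j ≤ suc n′
  j≤n = ℕP.≤-trans j≤⌊n+1/2⌋ ⌊n+1/2⌋≤n
  necessary : Represented (suc n′) (k * suc (suc n′)) i (ℓ * suc (suc n′)) j → ScaleCongruence (suc n′) i j k ℓ
  necessary (σ , σ-∈ , σ-+ , σ-Q) =
    Necessity.necessary n′ i j k ℓ i≤n j≤n 1≤k (λ x → proj₁ (rootSubY x)) σ σ-∈ σ-+ σ-Q
  sufficient : ScaleCongruence (suc n′) i j k ℓ → Represented (suc n′) (k * suc (suc n′)) i (ℓ * suc (suc n′)) j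
  sufficient (t , _ , congruence , k≡ℓt²)
    with e , c , ±e , ei-tj≡cN ← congruence⇒signed-quotient (suc (suc n′)) i j t congruence =
    signed-scaling-represents (suc n′) i j k ℓ t e c (ℕP.m≤n⇒m≤1+n i≤n) (ℕP.m≤n⇒m≤1+n j≤n) ±e ei-tj≡cN k≡ℓt²
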